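{- Let $n\ge 2$. The map $V_0$ induces a well-defined map $V$ from the set of circular permutations of $S_n$ to the set of admitted vectors, $V((w))=V_0(w)$, and $V$ is an isomorphism of graded posets, where circular permutations carry the order generated by the relation $\to$ and admitted vectors are ordered componentwise. Its inverse is determined as follows: if $w=1w'\in S_n$ (a word beginning with the letter $1$) and $V_0(w)=v$, then $\gamma_{ij}(w)=\delta_{1ij}(v)$ for all $1\le i<j\le n$.
   Context: Permutations $w\in S_n$ are viewed as words on $\{1,\ldots,n\}$; a circular factor of $w$ is a contiguous factor of some cyclic rotation $yx$ of $w=xy$. A circular permutation is an $n$-cycle in $S_n$; $(w)$ denotes the $n$-cycle $w_1\mapsto\cdots\mapsto w_n\mapsto w_1$, and $(w)=(w')$ iff $w,w'$ are cyclic rotations of each other. The relation $(w)\to(w')$ holds if $w$ has a circular factor $sr$ with $s>r+1$ and $w'$ is obtained by replacing it with $rs$; the poset of circular permutations is ordered by the reflexive transitive closure of $\to$. For $i<j$, $\gamma_{ij}(w)=1$ if $j$ appears before $i$ in $w$ and $0$ otherwise. Let $T=\{(i,j):1\le i<j\le n\}$. A vector $v\in\mathbb{N}^T$ is admitted if $v_{i,i+1}=0$ for all $i$ and $v_{ij}+v_{jk}\le v_{ik}\le v_{ij}+v_{jk}+1$ for all $i<j<k$. $V_0(w)\in\mathbb Z^T$ is defined by $V_0(w)_{ij}=-\gamma_{ij}(w)+\sum_{i\le k<j}\gamma_{k,k+1}(w)$. For $v\in\mathbb{N}^T$ and $1\le i\le j\le k\le n$, $\delta_{ijk}(v)=v_{ik}-v_{ij}-v_{jk}$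 with the convention $v_{ii}=0$. The grading of circular permutations is $N(w)=\sum_{k=1}^{n-1}k(n-k)\gamma_{k,k+1}(w)-\sum_{i<j}\gamma_{ij}(w)$ and that of admitted vectors is the sum of the components. -}

module Defs where

open import Data.Bool using (Bool; true; false; if_then_else_; _∨_)
open import Data.Nat as ℕ using (ℕ; zero; suc; _≡ᵇ_; _∸_)
import Data.Nat.Properties
open import Data.Integer as ℤ using (ℤ; +_; -_; _-_)
open import Data.List using (List; []; _∷_; _++_; map; upTo; concatMap; foldr)
open import Data.List.Relation.Binary.Permutation.Propositional using (_↭_)
open import Data.Product using (Σ; ∃; ∃-syntax; _×_; _,_)
open import Data.Sum using (_⊎_)
open import Relation.Binary.PropositionalEquality using (_≡_)
open import Relation.Binary.Construct.Closure.ReflexiveTransitive using (Star)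

-- Words are lists of naturals; the letters of S_n are 1,…,n.
letters : ℕ → List ℕ
letters n = map suc (upTo n)

IsPerm : ℕ → List ℕ → Set
IsPerm n w = w ↭ letters n

mem : ℕ → List ℕ → Bool
mem b [] = false
mem b (x ∷ xs) = (x ≡ᵇ b) ∨ mem b xs

before : ℕ → ℕ → List ℕ → Bool
before a b [] = false
before a b (x ∷ xs) = if x ≡ᵇ a then mem b xs else before a b xs

γ : ℕ → ℕ → List ℕ → ℤ
γ i j w = if before j i w then + 1 else + 0

-- w' is a cyclic rotation of w  (so (w) = (w') as circular permutations)
Rot : List ℕ → List ℕ → Set
Rot w w' = ∃[ x ] ∃[ y ] (w ≡ x ++ y × w' ≡ y ++ x)

Step : List ℕ → List ℕ → Set
Step w w' = ∃[ s ] ∃[ r ] ∃[ u ]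
  (suc r ℕ.< s × Rot w (s ∷ r ∷ u) × Rot w' (r ∷ s ∷ u))

-- the order on circular permutations, on representatives:
-- reflexive–transitive closure of → (together with rotation, i.e. equality
-- of circular permutations)
CircLe : List ℕ → List ℕ → Set
CircLe = Star (λ a b → Rot a b ⊎ Step a b)

-- vectors indexed by T are represented as functions ℕ → ℕ → ℤ, only their
-- values at (i , j) with 1 ≤ i < j ≤ n matter.
InT : ℕ → ℕ → ℕ → Set
InT n i j = 1 ℕ.≤ i × i ℕ.< j × j ℕ.≤ n

EqT : ℕ → (ℕ → ℕ → ℤ) → (ℕ → ℕ → ℤ) → Set
EqT n v v' = ∀ i j → InT n i j → v i j ≡ v' i j

LeT : ℕ → (ℕ → ℕ → ℤ) → (ℕ → ℕ → ℤ) → Set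
LeT n v v' = ∀ i j → InT n i j → v i j ℤ.≤ v' i j

Admitted : ℕ → (ℕ → ℕ → ℤ) → Set
Admitted n v =
  (∀ i j → InT n i j → + 0 ℤ.≤ v i j)
  × (∀ i → 1 ℕ.≤ i → suc i ℕ.≤ n → v i (suc i) ≡ + 0)
  × (∀ i j k → 1 ℕ.≤ i → i ℕ.< j → j ℕ.< k → k ℕ.≤ n →
       (v i j ℤ.+ v j k ℤ.≤ v i k) × (v i k ℤ.≤ v i j ℤ.+ v j k ℤ.+ + 1))

sumℤ : List ℤ → ℤ
sumℤ = foldr ℤ._+_ (+ 0)

sumRange : ℕ → ℕ → (ℕ → ℤ) → ℤ
sumRange i j f = sumℤ (map (λ t → f (i ℕ.+ t)) (upTo (j ∸ i)))

V₀ : List ℕ → ℕ → ℕ → ℤ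
V₀ w i j = - γ i j w ℤ.+ sumRange i j (λ k → γ k (suc k) w)

pairsT : ℕ → List (ℕ × ℕ)
pairsT n = concatMap (λ j → map (λ i → (suc i , suc j)) (upTo j)) (upTo n)

sumT : ℕ → (ℕ → ℕ → ℤ) → ℤ
sumT n f = sumℤ (map (λ { (i , j) → f i j }) (pairsT n))

gradeV : ℕ → (ℕ → ℕ → ℤ) → ℤ
gradeV n v = sumT n v

N : ℕ → List ℕ → ℤ
N n w = sumRange 1 n (λ k → + (k ℕ.* (n ∸ k)) ℤ.* γ k (suc k) w)
        ℤ.- sumT n (λ i j → γ i j w)

diag0 : (ℕ → ℕ → ℤ) → ℕ → ℕ → ℤ
diag0 v i j = if i ≡ᵇ j then + 0 else v i j

δ : (ℕ → ℕ → ℤ) → ℕ → ℕ → ℕ → ℤ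
δ v i j k = diag0 v i k ℤ.- diag0 v i j ℤ.- diag0 v j k

{-# OPTIONS --safe #-}
-- V₀ w is built from the inversion indicators γ, and its transitivity defects
-- δ_{ijk}(V₀ w) = γ_ij + γ_jk − γ_ik lie in {0, 1} because "comes before" is a
-- total order on the letters of w: this is admissibility.  Moving the first
-- letter to the end changes γ by a coboundary, so the defects and hence V₀ are
-- invariant under rotation.  Rotating 1 to the front gives γ_1j = 0, so
-- γ_ij = δ_{1ij}(V₀ w) recovers the word: V is injective, and for an admitted v
-- the values δ_{1ij}(v) are the inversions of a total order, along which the
-- letters can be sorted into a preimage.  A step (w) → (w') raises exactly the
-- coordinate (r, s) by one.  Conversely, if V₀ w ≤ v with v admitted, compare row i
-- along w rotated to begin with i, from right to left: the triangle inequalities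
-- of v force either equality or an adjacent descent s r with V_rs < v_rs, whose
-- swap climbs towards v; the grading of V₀ w bounds the climb.  The grading
-- itself is the double-sum identity Σ_{i<j} Σ_{i≤k<j} c_k = Σ_k k(n − k) c_k.

module Submission where

open import Defs
open import Data.Nat using (ℕ; _≤_)
open import Data.List using (List; _∷_)
open import Data.Product using (_×_; ∃-syntax)
open import Relation.Binary.PropositionalEquality using (_≡_)

open import Data.Bool using (Bool; true; false; not; if_then_else_)
import Data.Bool.Properties as Boolₚ
open import Data.Empty using (⊥-elim)
open import Data.Nat as ℕ using (zero; suc; _<_; _≟_; _≡ᵇ_; _∸_; z≤n; s≤s)
import Data.Nat.Properties as ℕₚ
open import Data.Integer as ℤ using (ℤ; +_; -_; _+_; _-_; _*_)
  renaming (_≤_ to _≤ℤ_; _<_ to _<ℤ_)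
import Data.Integer.Properties as ℤₚ
open import Data.Integer.Tactic.RingSolver using (solve-∀)
open import Data.List using ([]; [_]; _++_; map; applyUpTo; upTo; concatMap; foldr)
import Data.List.Properties as Listₚ
open import Data.List.Membership.Propositional using (_∈_; _∉_)
import Data.List.Membership.Propositional.Properties as ∈ₚ
open import Data.List.Relation.Unary.Any using (here; there)
open import Data.List.Relation.Unary.AllPairs as AllPairs using (AllPairs; []; _∷_)
open import Data.List.Relation.Unary.All as All using (All; []; _∷_)
open import Data.List.Relation.Unary.Unique.Propositional using (Unique)
import Data.List.Relation.Unary.Unique.Propositional.Properties as Uniqueₚ
open import Data.List.Relation.Binary.Permutation.Propositional
  using (_↭_; ↭-refl; ↭-prep; ↭-swap; ↭-sym; ↭-trans; ↭⇒↭ₛ)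
import Data.List.Relation.Binary.Permutation.Propositional.Properties as ↭ₚ
import Data.List.Relation.Binary.Permutation.Setoid.Properties as ↭ₛ
open import Data.Product using (_,_; proj₁; proj₂)
open import Data.Sum using (_⊎_; inj₁; inj₂)
open import Function using (_∘_; id; case_of_)
open import Relation.Nullary using (¬_; Dec; yes; no; contradiction)
open import Relation.Nullary.Decidable using (dec-true; dec-false)
open import Relation.Binary.Definitions using (Tri; tri<; tri≈; tri>)
open import Relation.Binary.PropositionalEquality
  using (_≢_; refl; sym; trans; cong; cong₂; subst; subst₂; setoid; module ≡-Reasoning)
open import Relation.Binary.Construct.Closure.ReflexiveTransitive using (ε; _◅_; _◅◅_)

cong₃ : ∀ {A B C D : Set} (f : A → B → C → D) {a a' b b' c c'} → a ≡ a' → b ≡ b' → c ≡ c' → f a b c ≡ f a' b' c'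
cong₃ f refl refl refl = refl

-- does (m ≟ n) is definitionally m ≡ᵇ n, the test used by mem and before
≡ᵇ-refl : ∀ m → (m ≡ᵇ m) ≡ true
≡ᵇ-refl m = dec-true (m ≟ m) refl

≢⇒≡ᵇ≡false : ∀ {m n} → m ≢ n → (m ≡ᵇ n) ≡ false
≢⇒≡ᵇ≡false {m} {n} = dec-false (m ≟ n)

∈-∷⁻ : ∀ {a x} {xs : List ℕ} → a ∈ x ∷ xs → a ≢ x → a ∈ xs
∈-∷⁻ (here a≡x) a≢x = ⊥-elim (a≢x a≡x)
∈-∷⁻ (there a∈xs) _ = a∈xs

∉-head : ∀ {x} {xs : List ℕ} → Unique (x ∷ xs) → x ∉ xs
∉-head = Uniqueₚ.Unique[x∷xs]⇒x∉xs

Unique-resp-↭ : ∀ {xs ys : List ℕ} → xs ↭ ys → Unique xs → Unique ys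
Unique-resp-↭ p = ↭ₛ.Unique-resp-↭ (setoid ℕ) (↭⇒↭ₛ p)

-- Membership and relative position of letters

mem-∈ : ∀ {b xs} → b ∈ xs → mem b xs ≡ true
mem-∈ {b} (here refl) rewrite ≡ᵇ-refl b = refl
mem-∈ {b} {x ∷ xs} (there b∈xs) rewrite mem-∈ b∈xs = Boolₚ.∨-zeroʳ (x ≡ᵇ b)

mem-∉ : ∀ {b} xs → b ∉ xs → mem b xs ≡ false
mem-∉ [] _ = refl
mem-∉ (x ∷ xs) b∉ rewrite ≢⇒≡ᵇ≡false (λ x≡b → b∉ (here (sym x≡b))) = mem-∉ xs (b∉ ∘ there)

mem⇒∈ : ∀ {b} xs → mem b xs ≡ true → b ∈ xs
mem⇒∈ {b} (x ∷ xs) eq with x ≟ b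
... | yes refl = here refl
... | no x≢b rewrite ≢⇒≡ᵇ≡false x≢b = there (mem⇒∈ xs eq)

before-head : ∀ a b xs → before a b (a ∷ xs) ≡ mem b xs
before-head a b xs rewrite ≡ᵇ-refl a = refl

before-∷ : ∀ {a b x} xs → x ≢ a → before a b (x ∷ xs) ≡ before a b xs
before-∷ xs x≢a rewrite ≢⇒≡ᵇ≡false x≢a = refl

before-∉ʳ : ∀ {a b} xs → b ∉ xs → before a b xs ≡ false
before-∉ʳ [] _ = refl
before-∉ʳ {a} (x ∷ xs) b∉ with x ≡ᵇ a
... | true = mem-∉ xs (b∉ ∘ there)
... | false = before-∉ʳ xs (b∉ ∘ there)

before⇒∈ : ∀ {a b} xs → before a b xs ≡ true → b ∈ xs
before⇒∈ {a} (x ∷ xs) ab with x ≟ a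
... | yes refl rewrite ≡ᵇ-refl x = there (mem⇒∈ xs ab)
... | no x≢a rewrite ≢⇒≡ᵇ≡false x≢a = there (before⇒∈ xs ab)

before-++ : ∀ {a b} (xs ys : List ℕ) → a ∉ xs → before a b (xs ++ ys) ≡ before a b ys
before-++ [] ys _ = refl
before-++ (x ∷ xs) ys a∉ =
  trans (before-∷ (xs ++ ys) (λ x≡a → a∉ (here (sym x≡a)))) (before-++ xs ys (a∉ ∘ there))

mem-∷ʳ : ∀ {b c} xs → c ≢ b → mem b (xs ++ [ c ]) ≡ mem b xs
mem-∷ʳ [] c≢b rewrite ≢⇒≡ᵇ≡false c≢b = refl
mem-∷ʳ (x ∷ xs) c≢b rewrite mem-∷ʳ xs c≢b = refl

before-∷ʳ : ∀ {a b c} xs → c ≢ b → before a b (xs ++ [ c ]) ≡ before a b xs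
before-∷ʳ {a} {c = c} [] _ with c ≡ᵇ a
... | true = refl
... | false = refl
before-∷ʳ {a} (x ∷ xs) c≢b with x ≡ᵇ a
... | true = mem-∷ʳ xs c≢b
... | false = before-∷ʳ xs c≢b

before-last : ∀ {a c} xs → a ∈ xs → before a c (xs ++ [ c ]) ≡ true
before-last {a} {c} (x ∷ xs) a∈ with x ≟ a
... | yes refl = trans (before-head x c (xs ++ [ c ])) (mem-∈ (∈ₚ.∈-++⁺ʳ xs (here refl)))
... | no x≢a = trans (before-∷ (xs ++ [ c ]) x≢a) (before-last xs (∈-∷⁻ a∈ (x≢a ∘ sym)))

before-asym : ∀ {a b w} → Unique w → before a b w ≡ true → before b a w ≡ false
before-asym {a} {b} {x ∷ xs} u ab with x ≟ a
... | yes refl rewrite before-head x b xs =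
  trans (before-∷ xs (λ x≡b → ∉-head u (subst (_∈ xs) (sym x≡b) (mem⇒∈ xs ab)))) (before-∉ʳ xs (∉-head u))
... | no x≢a rewrite before-∷ {a} {b} xs x≢a =
  trans (before-∷ xs (λ x≡b → ∉-head u (subst (_∈ xs) (sym x≡b) (before⇒∈ xs ab))))
        (before-asym (AllPairs.tail u) ab)

before-trans : ∀ {a b c w} → Unique w → before a b w ≡ true → before b c w ≡ true → before a c w ≡ true
before-trans {a} {b} {c} {x ∷ xs} u ab bc with x ≟ a
... | yes refl rewrite before-head x b xs | before-head x c xs =
  mem-∈ (before⇒∈ xs (trans (sym (before-∷ xs x≢b)) bc))
  where
  x≢b : x ≢ b
  x≢b x≡b = ∉-head u (subst (_∈ xs) (sym x≡b) (mem⇒∈ xs ab))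
... | no x≢a rewrite before-∷ {a} {b} xs x≢a | before-∷ {a} {c} xs x≢a =
  before-trans (AllPairs.tail u) ab (trans (sym (before-∷ xs x≢b)) bc)
  where
  x≢b : x ≢ b
  x≢b x≡b = ∉-head u (subst (_∈ xs) (sym x≡b) (before⇒∈ xs ab))

before-total : ∀ {a b} xs → a ≢ b → a ∈ xs → b ∈ xs → before a b xs ≡ true ⊎ before b a xs ≡ true
before-total {a} {b} (x ∷ xs) a≢b a∈ b∈ with x ≟ a | x ≟ b
... | yes refl | _ = inj₁ (trans (before-head x b xs) (mem-∈ (∈-∷⁻ b∈ (a≢b ∘ sym))))
... | no _ | yes refl = inj₂ (trans (before-head x a xs) (mem-∈ (∈-∷⁻ a∈ a≢b)))
... | no x≢a | no x≢b rewrite before-∷ {a} {b} xs x≢a | before-∷ {b} {a} xs x≢b =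
  before-total xs a≢b (∈-∷⁻ a∈ (x≢a ∘ sym)) (∈-∷⁻ b∈ (x≢b ∘ sym))

before-complement : ∀ {a b w} → Unique w → a ≢ b → a ∈ w → b ∈ w → before a b w ≡ not (before b a w)
before-complement {a} {b} {w} u a≢b a∈ b∈ with before-total w a≢b a∈ b∈
... | inj₁ ab rewrite ab | before-asym u ab = refl
... | inj₂ ba rewrite ba | before-asym u ba = refl

before-swap : ∀ {a b r s} xs → r ≢ s → ¬ (a ≡ s × b ≡ r) → ¬ (a ≡ r × b ≡ s) →
              before a b (s ∷ r ∷ xs) ≡ before a b (r ∷ s ∷ xs)
before-swap {a} {b} {r} {s} xs r≢s not-sr not-rs with a ≟ s | a ≟ r
... | yes refl | yes refl = ⊥-elim (r≢s refl)
... | yes refl | no a≢r rewrite before-head a b (r ∷ xs) | ≢⇒≡ᵇ≡false (λ r≡b → not-sr (refl , sym r≡b)) =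
  sym (trans (before-∷ (a ∷ xs) r≢s) (before-head a b xs))
... | no a≢s | yes refl rewrite before-head a b (s ∷ xs) | ≢⇒≡ᵇ≡false (λ s≡b → not-rs (refl , sym s≡b)) =
  trans (before-∷ (a ∷ xs) (a≢s ∘ sym)) (before-head a b xs)
... | no a≢s | no a≢r =
  trans (before-∷ (r ∷ xs) (a≢s ∘ sym)) (trans (before-∷ xs (a≢r ∘ sym))
    (sym (trans (before-∷ (s ∷ xs) (a≢r ∘ sym)) (before-∷ xs (a≢s ∘ sym)))))

-- Permutations of the letters 1, …, n

Letter : ℕ → ℕ → Set
Letter n x = 1 ≤ x × x ≤ n

∈-letters⁺ : ∀ {n x} → Letter n x → x ∈ letters n
∈-letters⁺ {x = suc i} (s≤s z≤n , i<n) = ∈ₚ.∈-map⁺ suc (∈ₚ.∈-upTo⁺ i<n)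

∈-letters⁻ : ∀ {n x} → x ∈ letters n → Letter n x
∈-letters⁻ x∈ with ∈ₚ.∈-map⁻ suc x∈
... | _ , i∈ , refl = s≤s z≤n , ∈ₚ.∈-upTo⁻ i∈

letters-unique : ∀ n → Unique (letters n)
letters-unique n = Uniqueₚ.map⁺ ℕₚ.suc-injective (Uniqueₚ.upTo⁺ n)

module _ {n w} (p : IsPerm n w) where

  perm-unique : Unique w
  perm-unique = Unique-resp-↭ (↭-sym p) (letters-unique n)

  perm-∋ : ∀ {x} → Letter n x → x ∈ w
  perm-∋ x = ↭ₚ.∈-resp-↭ (↭-sym p) (∈-letters⁺ x)

  perm-letter : ∀ {x} → x ∈ w → Letter n x
  perm-letter x∈ = ∈-letters⁻ (↭ₚ.∈-resp-↭ p x∈)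

rotate-perm : ∀ {n w w'} → IsPerm n w → Rot w w' → IsPerm n w'
rotate-perm p (x , y , refl , refl) = ↭-trans (↭ₚ.++-comm y x) p

Rot-sym : ∀ {w w'} → Rot w w' → Rot w' w
Rot-sym (x , y , w≡xy , w'≡yx) = y , x , w'≡yx , w≡xy

-- Finite sums

sumTo : (ℕ → ℤ) → ℕ → ℤ
sumTo f zero = + 0
sumTo f (suc m) = f 0 + sumTo (f ∘ suc) m

sumℤ-map-applyUpTo : ∀ (h : ℕ → ℤ) g m → sumℤ (map h (applyUpTo g m)) ≡ sumTo (h ∘ g) m
sumℤ-map-applyUpTo h g zero = refl
sumℤ-map-applyUpTo h g (suc m) = cong (_+_ (h (g 0))) (sumℤ-map-applyUpTo h (g ∘ suc) m)

sumRange≡sumTo : ∀ i j f → sumRange i j f ≡ sumTo (λ t → f (i ℕ.+ t)) (j ∸ i)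
sumRange≡sumTo i j f = sumℤ-map-applyUpTo _ id (j ∸ i)

sumTo-cong : ∀ {f g} m → (∀ t → t < m → f t ≡ g t) → sumTo f m ≡ sumTo g m
sumTo-cong zero _ = refl
sumTo-cong (suc m) f≗g = cong₂ _+_ (f≗g 0 (s≤s z≤n)) (sumTo-cong m (λ t t<m → f≗g (suc t) (s≤s t<m)))

sumTo-suc : ∀ f m → sumTo f (suc m) ≡ sumTo f m + f m
sumTo-suc f zero = ℤₚ.+-comm (f 0) (+ 0)
sumTo-suc f (suc m) = trans (cong (_+_ (f 0)) (sumTo-suc (f ∘ suc) m)) (sym (ℤₚ.+-assoc (f 0) _ _))

sumTo-split : ∀ f m k → sumTo f (m ℕ.+ k) ≡ sumTo f m + sumTo (λ t → f (m ℕ.+ t)) k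
sumTo-split f zero k = sym (ℤₚ.+-identityˡ _)
sumTo-split f (suc m) k = trans (cong (_+_ (f 0)) (sumTo-split (f ∘ suc) m k)) (sym (ℤₚ.+-assoc (f 0) _ _))

sumTo-+ : ∀ f g m → sumTo (λ t → f t + g t) m ≡ sumTo f m + sumTo g m
sumTo-+ f g zero = refl
sumTo-+ f g (suc m) = trans (cong (_+_ (f 0 + g 0)) (sumTo-+ (f ∘ suc) (g ∘ suc) m)) (interchange (f 0) (g 0) _ _)
  where
  interchange : ∀ a b c d → (a + b) + (c + d) ≡ (a + c) + (b + d)
  interchange = solve-∀

sumTo-neg : ∀ f m → sumTo (λ t → - f t) m ≡ - sumTo f m
sumTo-neg f zero = refl
sumTo-neg f (suc m) = trans (cong (_+_ (- f 0)) (sumTo-neg (f ∘ suc) m)) (sym (ℤₚ.neg-distrib-+ (f 0) _))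

sumTo-const : ∀ x m → sumTo (λ _ → x) m ≡ + m * x
sumTo-const x zero = sym (ℤₚ.*-zeroˡ x)
sumTo-const x (suc m) = trans (cong (_+_ x) (sumTo-const x m)) (distrib x (+ m))
  where
  distrib : ∀ x k → x + k * x ≡ (+ 1 + k) * x
  distrib = solve-∀

sumTo-mono : ∀ f g m → (∀ t → t < m → f t ≤ℤ g t) → sumTo f m ≤ℤ sumTo g m
sumTo-mono f g zero _ = ℤₚ.≤-refl
sumTo-mono f g (suc m) f≤g =
  ℤₚ.+-mono-≤ (f≤g 0 (s≤s z≤n)) (sumTo-mono (f ∘ suc) (g ∘ suc) m (λ t t<m → f≤g (suc t) (s≤s t<m)))

sumTo-mono-< : ∀ f g m → (∀ t → t < m → f t ≤ℤ g t) → ∀ s → s < m → f s <ℤ g s → sumTo f m <ℤ sumTo g m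
sumTo-mono-< f g (suc m) f≤g zero _ fs<gs =
  ℤₚ.+-mono-<-≤ fs<gs (sumTo-mono (f ∘ suc) (g ∘ suc) m (λ t t<m → f≤g (suc t) (s≤s t<m)))
sumTo-mono-< f g (suc m) f≤g (suc s) (s≤s s<m) fs<gs =
  ℤₚ.+-mono-≤-< (f≤g 0 (s≤s z≤n))
    (sumTo-mono-< (f ∘ suc) (g ∘ suc) m (λ t t<m → f≤g (suc t) (s≤s t<m)) s s<m fs<gs)

∸-split : ∀ {i j k} → i ≤ j → j ≤ k → k ∸ i ≡ (j ∸ i) ℕ.+ (k ∸ j)
∸-split {i} {j} {k} i≤j j≤k =
  trans (cong (_∸ i) (sym (ℕₚ.m+[n∸m]≡n j≤k))) (ℕₚ.+-∸-comm (k ∸ j) i≤j)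

sumRange-split : ∀ {i j k} f → i ≤ j → j ≤ k → sumRange i k f ≡ sumRange i j f + sumRange j k f
sumRange-split {i} {j} {k} f i≤j j≤k = begin
  sumRange i k f                                          ≡⟨ sumRange≡sumTo i k f ⟩
  sumTo (λ t → f (i ℕ.+ t)) (k ∸ i)                        ≡⟨ cong (sumTo _) (∸-split i≤j j≤k) ⟩
  sumTo (λ t → f (i ℕ.+ t)) ((j ∸ i) ℕ.+ (k ∸ j))          ≡⟨ sumTo-split _ (j ∸ i) (k ∸ j) ⟩
  sumTo (λ t → f (i ℕ.+ t)) (j ∸ i)
    + sumTo (λ t → f (i ℕ.+ ((j ∸ i) ℕ.+ t))) (k ∸ j)      ≡⟨ cong₂ _+_ (sym (sumRange≡sumTo i j f))
                                                               (sumTo-cong (k ∸ j) (λ t _ → cong f (shift t))) ⟩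
  sumRange i j f + sumTo (λ t → f (j ℕ.+ t)) (k ∸ j)       ≡⟨ cong (_+_ (sumRange i j f)) (sym (sumRange≡sumTo j k f)) ⟩
  sumRange i j f + sumRange j k f                          ∎
  where
  open ≡-Reasoning
  shift : ∀ t → i ℕ.+ ((j ∸ i) ℕ.+ t) ≡ j ℕ.+ t
  shift t = trans (sym (ℕₚ.+-assoc i (j ∸ i) t)) (cong (ℕ._+ t) (ℕₚ.m+[n∸m]≡n i≤j))

sumRange-cong : ∀ {f g} i j → (∀ k → f k ≡ g k) → sumRange i j f ≡ sumRange i j g
sumRange-cong i j f≗g = cong sumℤ (Listₚ.map-cong (λ t → f≗g (i ℕ.+ t)) (upTo (j ∸ i)))

sumRange-suc : ∀ i f → sumRange i (suc i) f ≡ f i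
sumRange-suc i f rewrite sumRange≡sumTo i (suc i) f | ℕₚ.m+n∸n≡m 1 i | ℕₚ.+-identityʳ i =
  ℤₚ.+-identityʳ (f i)

-- The vector V₀ and its transitivity defects

γ⁺ : List ℕ → ℕ → ℤ
γ⁺ w k = γ k (suc k) w

-- δ_{ijk}(V₀ w) in terms of the inversion indicators, see δ-V₀
defect : List ℕ → ℕ → ℕ → ℕ → ℤ
defect w i j k = γ i j w + γ j k w - γ i k w

V₀+γ≡sumRange : ∀ w i j → V₀ w i j + γ i j w ≡ sumRange i j (γ⁺ w)
V₀+γ≡sumRange w i j = cancel (γ i j w) (sumRange i j (γ⁺ w))
  where
  cancel : ∀ x s → (- x + s) + x ≡ s
  cancel = solve-∀

V₀-diag : ∀ w i → V₀ w i (suc i) ≡ + 0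
V₀-diag w i = trans (cong (_+_ (- γ⁺ w i)) (sumRange-suc i (γ⁺ w))) (ℤₚ.+-inverseˡ (γ⁺ w i))

V₀-split : ∀ w {i j k} → i ≤ j → j ≤ k → V₀ w i k ≡ V₀ w i j + V₀ w j k + defect w i j k
V₀-split w {i} {j} {k} i≤j j≤k = begin
  V₀ w i k                                              ≡⟨ add-sub (V₀ w i k) (γ i k w) ⟩
  (V₀ w i k + γ i k w) - γ i k w                        ≡⟨ cong (_- γ i k w) sums ⟩
  (V₀ w i j + γ i j w) + (V₀ w j k + γ j k w) - γ i k w  ≡⟨ regroup (V₀ w i j) (γ i j w) (V₀ w j k) _ _ ⟩
  V₀ w i j + V₀ w j k + defect w i j k                   ∎
  where
  open ≡-Reasoning
  add-sub : ∀ a b → a ≡ (a + b) - b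
  add-sub = solve-∀
  regroup : ∀ a b c d e → (a + b) + (c + d) - e ≡ a + c + (b + d - e)
  regroup = solve-∀
  sums : V₀ w i k + γ i k w ≡ (V₀ w i j + γ i j w) + (V₀ w j k + γ j k w)
  sums = trans (V₀+γ≡sumRange w i k) (trans (sumRange-split (γ⁺ w) i≤j j≤k)
           (sym (cong₂ _+_ (V₀+γ≡sumRange w i j) (V₀+γ≡sumRange w j k))))

V₀-suc : ∀ w {i j} → i ≤ j → V₀ w i (suc j) ≡ V₀ w i j + defect w i j (suc j)
V₀-suc w {i} {j} i≤j = begin
  V₀ w i (suc j)                                    ≡⟨ V₀-split w i≤j (ℕₚ.n≤1+n j) ⟩
  V₀ w i j + V₀ w j (suc j) + defect w i j (suc j)   ≡⟨ cong (λ x → V₀ w i j + x + defect w i j (suc j)) (V₀-diag w j) ⟩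
  V₀ w i j + + 0 + defect w i j (suc j)              ≡⟨ cong (_+ defect w i j (suc j)) (ℤₚ.+-identityʳ (V₀ w i j)) ⟩
  V₀ w i j + defect w i j (suc j)                   ∎
  where open ≡-Reasoning

Bit : ℤ → Set
Bit x = x ≡ + 0 ⊎ x ≡ + 1

Bit⇒0≤ : ∀ {x} → Bit x → + 0 ≤ℤ x
Bit⇒0≤ (inj₁ refl) = ℤₚ.≤-refl
Bit⇒0≤ (inj₂ refl) = ℤ.+≤+ z≤n

Bit⇒≤1 : ∀ {x} → Bit x → x ≤ℤ + 1
Bit⇒≤1 (inj₁ refl) = ℤ.+≤+ z≤n
Bit⇒≤1 (inj₂ refl) = ℤₚ.≤-refl

0≤∧≤1⇒Bit : ∀ {x} → + 0 ≤ℤ x → x ≤ℤ + 1 → Bit x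
0≤∧≤1⇒Bit {+ 0} _ _ = inj₁ refl
0≤∧≤1⇒Bit {+ 1} _ _ = inj₂ refl
0≤∧≤1⇒Bit {+ suc (suc _)} _ (ℤ.+≤+ (s≤s ()))

+Bit-bounds : ∀ {x y d} → x ≡ y + d → Bit d → y ≤ℤ x × x ≤ℤ y + + 1
+Bit-bounds {y = y} refl d =
  subst (_≤ℤ y + _) (ℤₚ.+-identityʳ y) (ℤₚ.+-monoʳ-≤ y (Bit⇒0≤ d)) , ℤₚ.+-monoʳ-≤ y (Bit⇒≤1 d)

indicator : Bool → ℤ
indicator b = if b then + 1 else + 0

indicator-defect : ∀ b₁ b₂ b₃ →
                   (b₁ ≡ false → b₂ ≡ false → b₃ ≡ false) → (b₁ ≡ true → b₂ ≡ true → b₃ ≡ true) →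
                   Bit (indicator b₁ + indicator b₂ - indicator b₃)
indicator-defect false false false _ _ = inj₁ refl
indicator-defect false false true ff _ with () ← ff refl refl
indicator-defect false true false _ _ = inj₂ refl
indicator-defect false true true _ _ = inj₁ refl
indicator-defect true false false _ _ = inj₂ refl
indicator-defect true false true _ _ = inj₁ refl
indicator-defect true true false _ tt with () ← tt refl refl
indicator-defect true true true _ _ = inj₂ refl

before-flip : ∀ {a b w} → Unique w → a ≢ b → a ∈ w → b ∈ w → before a b w ≡ false → before b a w ≡ true
before-flip {a} {b} {w} u a≢b a∈ b∈ ab
  rewrite before-complement u (a≢b ∘ sym) b∈ a∈ | ab = refl

defect-Bit : ∀ {w i j k} → Unique w → i ∈ w → j ∈ w → k ∈ w → i ≢ j → j ≢ k → i ≢ k → Bit (defect w i j k)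
defect-Bit {w} {i} {j} {k} u i∈ j∈ k∈ i≢j j≢k i≢k =
  indicator-defect (before j i w) (before k j w) (before k i w) increasing decreasing
  where
  increasing : before j i w ≡ false → before k j w ≡ false → before k i w ≡ false
  increasing ji kj =
    before-asym u (before-trans u (before-flip u (i≢j ∘ sym) j∈ i∈ ji) (before-flip u (j≢k ∘ sym) k∈ j∈ kj))
  decreasing : before j i w ≡ true → before k j w ≡ true → before k i w ≡ true
  decreasing ji kj = before-trans u kj ji

module _ {n w} (p : IsPerm n w) {i j k} (1≤i : 1 ≤ i) (i<j : i < j) (j<k : j < k) (k≤n : k ≤ n) where

  private
    j≤n = ℕₚ.≤-trans (ℕₚ.<⇒≤ j<k) k≤n
    1≤j = ℕₚ.≤-trans 1≤i (ℕₚ.<⇒≤ i<j)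
    1≤k = ℕₚ.≤-trans 1≤j (ℕₚ.<⇒≤ j<k)

  perm-∋³ : i ∈ w × j ∈ w × k ∈ w
  perm-∋³ = perm-∋ p (1≤i , ℕₚ.≤-trans (ℕₚ.<⇒≤ i<j) j≤n) , perm-∋ p (1≤j , j≤n) , perm-∋ p (1≤k , k≤n)

  perm-defect-Bit : Bit (defect w i j k)
  perm-defect-Bit = let i∈ , j∈ , k∈ = perm-∋³ in
    defect-Bit (perm-unique p) i∈ j∈ k∈ (ℕₚ.<⇒≢ i<j) (ℕₚ.<⇒≢ j<k) (ℕₚ.<⇒≢ (ℕₚ.<-trans i<j j<k))

induction-from : ∀ {n} (P : ℕ → Set) i → P (suc i) → (∀ j → i < j → suc j ≤ n → P j → P (suc j)) →
                 ∀ j → i < j → j ≤ n → P j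
induction-from P i base step (suc j) (s≤s i≤j) sj≤n with ℕₚ.m≤n⇒m<n∨m≡n i≤j
... | inj₂ refl = base
... | inj₁ i<j = step j i<j sj≤n (induction-from P i base step j i<j (ℕₚ.<⇒≤ sj≤n))

EqT-by-columns : ∀ {n v v'} → (∀ i → 1 ≤ i → suc i ≤ n → v i (suc i) ≡ v' i (suc i)) →
                 (∀ i j → 1 ≤ i → i < j → suc j ≤ n → v i j ≡ v' i j → v i (suc j) ≡ v' i (suc j)) →
                 EqT n v v'
EqT-by-columns {v = v} {v'} diag step i j (1≤i , i<j , j≤n) =
  induction-from (λ j → v i j ≡ v' i j) i (diag i 1≤i (ℕₚ.≤-trans i<j j≤n)) (λ j → step i j 1≤i) j i<j j≤n

V₀-admitted : ∀ {n w} → IsPerm n w → Admitted n (V₀ w)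
V₀-admitted {n} {w} p = nonneg , (λ i _ _ → V₀-diag w i) , triangle
  where
  triangle : ∀ i j k → 1 ≤ i → i < j → j < k → k ≤ n →
             (V₀ w i j + V₀ w j k ≤ℤ V₀ w i k) × (V₀ w i k ≤ℤ V₀ w i j + V₀ w j k + + 1)
  triangle i j k 1≤i i<j j<k k≤n =
    +Bit-bounds (V₀-split w (ℕₚ.<⇒≤ i<j) (ℕₚ.<⇒≤ j<k)) (perm-defect-Bit p 1≤i i<j j<k k≤n)
  nonneg : ∀ i j → InT n i j → + 0 ≤ℤ V₀ w i j
  nonneg i j (1≤i , i<j , j≤n) = induction-from (λ j → + 0 ≤ℤ V₀ w i j) i (ℤₚ.≤-reflexive (sym (V₀-diag w i)))
    (λ j i<j sj≤n 0≤Vij → ℤₚ.≤-trans 0≤Vij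
      (proj₁ (+Bit-bounds (V₀-suc w (ℕₚ.<⇒≤ i<j)) (perm-defect-Bit p 1≤i i<j (ℕₚ.n<1+n j) sj≤n))))
    j i<j j≤n

-- Invariance under rotation

-- Moving the first letter a to the end changes γ by a coboundary, which
-- cancels in every defect.
γ-rotate : ∀ {a p q} u → a ∉ u → p ∈ a ∷ u → q ∈ a ∷ u → p ≢ q →
           γ p q (u ++ [ a ]) ≡ γ p q (a ∷ u) + indicator (p ≡ᵇ a) - indicator (q ≡ᵇ a)
γ-rotate {a} {p} {q} u a∉u p∈ q∈ p≢q with p ≟ a | q ≟ a
... | yes refl | yes refl = ⊥-elim (p≢q refl)
... | yes refl | no q≢a
  rewrite before-last {q} {p} u (∈-∷⁻ q∈ q≢a) | before-∷ {q} {p} u (q≢a ∘ sym) | before-∉ʳ {q} u a∉u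
        | ≡ᵇ-refl p | ≢⇒≡ᵇ≡false q≢a = refl
... | no p≢a | yes refl
  rewrite before-++ {q} {p} u [ q ] a∉u | before-head q p [] | before-head q p u | mem-∈ (∈-∷⁻ p∈ p≢a)
        | ≢⇒≡ᵇ≡false p≢a | ≡ᵇ-refl q = refl
... | no p≢a | no q≢a
  rewrite before-∷ʳ {q} {p} {a} u (p≢a ∘ sym) | before-∷ {q} {p} u (q≢a ∘ sym)
        | ≢⇒≡ᵇ≡false p≢a | ≢⇒≡ᵇ≡false q≢a = unit (γ p q u)
  where
  unit : ∀ x → x ≡ x + + 0 - + 0
  unit = solve-∀

defect-rotate : ∀ {a i j k} u → a ∉ u → i ∈ a ∷ u → j ∈ a ∷ u → k ∈ a ∷ u → i ≢ j → j ≢ k → i ≢ k →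
                defect (u ++ [ a ]) i j k ≡ defect (a ∷ u) i j k
defect-rotate {a} {i} {j} {k} u a∉u i∈ j∈ k∈ i≢j j≢k i≢k
  rewrite γ-rotate u a∉u i∈ j∈ i≢j | γ-rotate u a∉u j∈ k∈ j≢k | γ-rotate u a∉u i∈ k∈ i≢k =
  telescope (γ i j (a ∷ u)) (γ j k (a ∷ u)) (γ i k (a ∷ u))
            (indicator (i ≡ᵇ a)) (indicator (j ≡ᵇ a)) (indicator (k ≡ᵇ a))
  where
  telescope : ∀ x y z eᵢ eⱼ eₖ → (x + eᵢ - eⱼ) + (y + eⱼ - eₖ) - (z + eᵢ - eₖ) ≡ x + y - z
  telescope = solve-∀

DefectsAgree : ℕ → List ℕ → List ℕ → Set
DefectsAgree n w w' = ∀ i j k → 1 ≤ i → i < j → j < k → k ≤ n → defect w i j k ≡ defect w' i j k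

defects-rotate : ∀ {n} xs ys → IsPerm n (xs ++ ys) → DefectsAgree n (xs ++ ys) (ys ++ xs)
defects-rotate [] ys _ i j k _ _ _ _ = cong (λ w → defect w i j k) (sym (Listₚ.++-identityʳ ys))
defects-rotate {n} (a ∷ xs) ys p i j k 1≤i i<j j<k k≤n = begin
  defect (a ∷ xs ++ ys) i j k      ≡⟨ sym (defect-rotate (xs ++ ys) (∉-head (perm-unique p)) i∈ j∈ k∈
                                         (ℕₚ.<⇒≢ i<j) (ℕₚ.<⇒≢ j<k) (ℕₚ.<⇒≢ (ℕₚ.<-trans i<j j<k))) ⟩
  defect ((xs ++ ys) ++ [ a ]) i j k ≡⟨ cong (λ w → defect w i j k) (Listₚ.++-assoc xs ys [ a ]) ⟩
  defect (xs ++ ys ++ [ a ]) i j k  ≡⟨ defects-rotate xs (ys ++ [ a ]) p' i j k 1≤i i<j j<k k≤n ⟩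
  defect ((ys ++ [ a ]) ++ xs) i j k ≡⟨ cong (λ w → defect w i j k) (Listₚ.++-assoc ys [ a ] xs) ⟩
  defect (ys ++ a ∷ xs) i j k       ∎
  where
  open ≡-Reasoning
  i∈ = proj₁ (perm-∋³ p 1≤i i<j j<k k≤n)
  j∈ = proj₁ (proj₂ (perm-∋³ p 1≤i i<j j<k k≤n))
  k∈ = proj₂ (proj₂ (perm-∋³ p 1≤i i<j j<k k≤n))
  p' : IsPerm n (xs ++ ys ++ [ a ])
  p' = subst (IsPerm n) (Listₚ.++-assoc xs ys [ a ]) (↭-trans (↭ₚ.++-comm (xs ++ ys) [ a ]) p)

V₀-determined-by-defects : ∀ {n w w'} → DefectsAgree n w w' → EqT n (V₀ w) (V₀ w')
V₀-determined-by-defects {w = w} {w'} agree = EqT-by-columns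
  (λ i _ _ → trans (V₀-diag w i) (sym (V₀-diag w' i)))
  (λ i j 1≤i i<j sj≤n Vij≡ → trans (V₀-suc w (ℕₚ.<⇒≤ i<j))
     (trans (cong₂ _+_ Vij≡ (agree i j (suc j) 1≤i i<j (ℕₚ.n<1+n j) sj≤n)) (sym (V₀-suc w' (ℕₚ.<⇒≤ i<j)))))

V₀-rotate : ∀ {n w w'} → IsPerm n w → Rot w w' → EqT n (V₀ w) (V₀ w')
V₀-rotate p (xs , ys , refl , refl) = V₀-determined-by-defects {w = xs ++ ys} {ys ++ xs} (defects-rotate xs ys p)

-- The inverse map

diag0-≢ : ∀ v {a b} → a ≢ b → diag0 v a b ≡ v a b
diag0-≢ v a≢b rewrite ≢⇒≡ᵇ≡false a≢b = refl

δ-off-diagonal : ∀ v {i j k} → i < j → j < k → δ v i j k ≡ v i k - v i j - v j k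
δ-off-diagonal v i<j j<k
  rewrite diag0-≢ v (ℕₚ.<⇒≢ (ℕₚ.<-trans i<j j<k)) | diag0-≢ v (ℕₚ.<⇒≢ i<j) | diag0-≢ v (ℕₚ.<⇒≢ j<k)
  = refl

δ-V₀ : ∀ w {i j k} → i < j → j < k → δ (V₀ w) i j k ≡ defect w i j k
δ-V₀ w {i} {j} {k} i<j j<k rewrite δ-off-diagonal (V₀ w) i<j j<k | V₀-split w (ℕₚ.<⇒≤ i<j) (ℕₚ.<⇒≤ j<k) =
  cancel (V₀ w i j) (V₀ w j k) (defect w i j k)
  where
  cancel : ∀ a b d → a + b + d - a - b ≡ d
  cancel = solve-∀

γ-head : ∀ {a} xs → a ∉ xs → ∀ {x} → x ≢ a → γ a x (a ∷ xs) ≡ + 0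
γ-head {a} xs a∉ {x} x≢a rewrite before-∷ {x} {a} xs (x≢a ∘ sym) | before-∉ʳ {x} xs a∉ = refl

-- For i = 1 the convention v₁₁ = 0 makes δ₁₁ⱼ vanish, matching γ₁ⱼ = 0.
γ-from-V₀ : ∀ {n} w → IsPerm n (1 ∷ w) → ∀ i j → InT n i j → γ i j (1 ∷ w) ≡ δ (V₀ (1 ∷ w)) 1 i j
γ-from-V₀ w p i j (1≤i , i<j , _) with i ≟ 1
... | yes refl rewrite diag0-≢ (V₀ (1 ∷ w)) (ℕₚ.<⇒≢ i<j) =
  trans (γ-head w 1∉w (ℕₚ.<⇒≢ i<j ∘ sym)) (sym (cancel (V₀ (1 ∷ w) 1 j)))
  where
  1∉w = ∉-head (perm-unique p)
  cancel : ∀ x → x - + 0 - x ≡ + 0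
  cancel = solve-∀
... | no i≢1 = sym (begin
  δ (V₀ (1 ∷ w)) 1 i j                          ≡⟨ δ-V₀ (1 ∷ w) 1<i i<j ⟩
  γ 1 i (1 ∷ w) + γ i j (1 ∷ w) - γ 1 j (1 ∷ w)  ≡⟨ cong₂ (λ x y → x + γ i j (1 ∷ w) - y)
                                                    (γ-head w 1∉w i≢1) (γ-head w 1∉w (ℕₚ.<⇒≢ (ℕₚ.<-trans 1<i i<j) ∘ sym)) ⟩
  + 0 + γ i j (1 ∷ w) - + 0                      ≡⟨ zeros (γ i j (1 ∷ w)) ⟩
  γ i j (1 ∷ w)                                 ∎)
  where
  open ≡-Reasoning
  1∉w = ∉-head (perm-unique p)
  1<i = ℕₚ.≤∧≢⇒< 1≤i (i≢1 ∘ sym)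
  zeros : ∀ x → + 0 + x - + 0 ≡ x
  zeros = solve-∀

diag0-cong : ∀ {v v'} a b → (a ≢ b → v a b ≡ v' a b) → diag0 v a b ≡ diag0 v' a b
diag0-cong a b eq with a ≟ b
... | yes refl rewrite ≡ᵇ-refl a = refl
... | no a≢b rewrite ≢⇒≡ᵇ≡false a≢b = eq a≢b

δ₁-cong : ∀ {n v v'} → EqT n v v' → ∀ {i j} → InT n i j → δ v 1 i j ≡ δ v' 1 i j
δ₁-cong {v = v} {v'} v≡v' {i} {j} (1≤i , i<j , j≤n) = cong₂ _-_ (cong₂ _-_
  (diag0-cong {v} {v'} 1 j (λ _ → v≡v' 1 j (ℕₚ.≤-refl , ℕₚ.≤-<-trans 1≤i i<j , j≤n)))
  (diag0-cong {v} {v'} 1 i (λ 1≢i →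
    v≡v' 1 i (ℕₚ.≤-refl , ℕₚ.≤∧≢⇒< 1≤i 1≢i , ℕₚ.≤-trans (ℕₚ.<⇒≤ i<j) j≤n))))
  (diag0-cong {v} {v'} i j (λ _ → v≡v' i j (1≤i , i<j , j≤n)))

before-injective : ∀ w w' → Unique w → Unique w' → (∀ {x} → x ∈ w → x ∈ w') → (∀ {x} → x ∈ w' → x ∈ w) →
                   (∀ {a b} → a ∈ w → b ∈ w → a ≢ b → before a b w ≡ before a b w') → w ≡ w'
before-injective [] [] _ _ _ _ _ = refl
before-injective [] (y ∷ w') _ _ _ w'⊆w _ with () ← w'⊆w (here refl)
before-injective (x ∷ w) [] _ _ w⊆w' _ _ with () ← w⊆w' (here refl)
before-injective (x ∷ w) (y ∷ w') u u' w⊆w' w'⊆w same with x ≟ y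
... | no x≢y = contradiction (trans (sym x-first) (trans (same (here refl) y∈ x≢y) y-first)) λ ()
  where
  y∈ = w'⊆w (here refl)
  x-first : before x y (x ∷ w) ≡ true
  x-first = trans (before-head x y w) (mem-∈ (∈-∷⁻ y∈ (x≢y ∘ sym)))
  y-first : before x y (y ∷ w') ≡ false
  y-first = trans (before-∷ w' (x≢y ∘ sym)) (before-∉ʳ w' (∉-head u'))
... | yes refl = cong (x ∷_) (before-injective w w' (AllPairs.tail u) (AllPairs.tail u') ⊆ ⊇ same')
  where
  x≢ : ∀ {z ws} → Unique (x ∷ ws) → z ∈ ws → z ≢ x
  x≢ u z∈ z≡x = ∉-head u (subst (_∈ _) z≡x z∈)
  ⊆ : ∀ {z} → z ∈ w → z ∈ w'
  ⊆ z∈ = ∈-∷⁻ (w⊆w' (there z∈)) (x≢ u z∈)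
  ⊇ : ∀ {z} → z ∈ w' → z ∈ w
  ⊇ z∈ = ∈-∷⁻ (w'⊆w (there z∈)) (x≢ u' z∈)
  same' : ∀ {a b} → a ∈ w → b ∈ w → a ≢ b → before a b w ≡ before a b w'
  same' a∈ b∈ a≢b = trans (sym (before-∷ w (x≢ u a∈ ∘ sym)))
    (trans (same (there a∈) (there b∈) a≢b) (before-∷ w' (x≢ u a∈ ∘ sym)))

indicator-injective : ∀ {b b'} → indicator b ≡ indicator b' → b ≡ b'
indicator-injective {false} {false} _ = refl
indicator-injective {true} {true} _ = refl

γ-injective : ∀ {n w w'} → IsPerm n w → IsPerm n w' → (∀ i j → InT n i j → γ i j w ≡ γ i j w') → w ≡ w'
γ-injective {n} {w} {w'} p p' γ≡ =
  before-injective w w' (perm-unique p) (perm-unique p')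
    (perm-∋ p' ∘ perm-letter p) (perm-∋ p ∘ perm-letter p') same
  where
  same : ∀ {a b} → a ∈ w → b ∈ w → a ≢ b → before a b w ≡ before a b w'
  same {a} {b} a∈ b∈ a≢b with ℕₚ.<-cmp a b | perm-letter p a∈ | perm-letter p b∈
  ... | tri≈ _ a≡b _ | _ | _ = ⊥-elim (a≢b a≡b)
  ... | tri> _ _ b<a | _ , a≤n | 1≤b , _ = indicator-injective (γ≡ b a (1≤b , b<a , a≤n))
  ... | tri< a<b _ _ | 1≤a , a≤n | 1≤b , b≤n = begin
    before a b w        ≡⟨ before-complement (perm-unique p) a≢b a∈ b∈ ⟩
    not (before b a w)  ≡⟨ cong not (indicator-injective (γ≡ a b (1≤a , a<b , b≤n))) ⟩
    not (before b a w') ≡⟨ sym (before-complement (perm-unique p') a≢b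
                               (perm-∋ p' (1≤a , a≤n)) (perm-∋ p' (1≤b , b≤n))) ⟩
    before a b w'       ∎
    where open ≡-Reasoning

++-split : ∀ (xs ys xs' ys' : List ℕ) → xs ++ ys ≡ xs' ++ ys' →
           (∃[ m ] (xs' ≡ xs ++ m × ys ≡ m ++ ys')) ⊎ (∃[ m ] (xs ≡ xs' ++ m × ys' ≡ m ++ ys))
++-split [] ys xs' ys' eq = inj₁ (xs' , refl , eq)
++-split (x ∷ xs) ys [] ys' eq = inj₂ (x ∷ xs , refl , sym eq)
++-split (x ∷ xs) ys (x' ∷ xs') ys' eq with refl , eq' ← Listₚ.∷-injective eq with ++-split xs ys xs' ys' eq'
... | inj₁ (m , refl , refl) = inj₁ (m , refl , refl)
... | inj₂ (m , refl , refl) = inj₂ (m , refl , refl)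

Rot-trans : ∀ {w w' w''} → Rot w w' → Rot w' w'' → Rot w w''
Rot-trans (xs , ys , refl , w'≡) (xs' , ys' , w'≡' , refl) with ++-split ys xs xs' ys' (trans (sym w'≡) w'≡')
... | inj₁ (m , refl , refl) = m , ys' ++ ys , Listₚ.++-assoc m ys' ys , sym (Listₚ.++-assoc ys' ys m)
... | inj₂ (m , refl , refl) = xs ++ xs' , m , sym (Listₚ.++-assoc xs xs' m) , Listₚ.++-assoc m xs xs'

rotate-to-front : ∀ {a} w → a ∈ w → ∃[ u ] Rot w (a ∷ u)
rotate-to-front w a∈ with xs , ys , refl ← ∈ₚ.∈-∃++ a∈ = ys ++ xs , xs , _ ∷ ys , refl , refl

V₀-injective : ∀ {n} → 1 ≤ n → ∀ w w' → IsPerm n w → IsPerm n w' → EqT n (V₀ w) (V₀ w') → Rot w w'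
V₀-injective {n} 1≤n w w' p p' V≡V' with rotate-to-front w (perm-∋ p (ℕₚ.≤-refl , 1≤n))
                                        | rotate-to-front w' (perm-∋ p' (ℕₚ.≤-refl , 1≤n))
... | u , r | u' , r' = Rot-trans r (subst (λ x → Rot x w') (sym front-equal) (Rot-sym r'))
  where
  q = rotate-perm p r
  q' = rotate-perm p' r'
  V≡V'₁ : EqT n (V₀ (1 ∷ u)) (V₀ (1 ∷ u'))
  V≡V'₁ i j t = trans (sym (V₀-rotate p r i j t)) (trans (V≡V' i j t) (V₀-rotate p' r' i j t))
  front-equal : 1 ∷ u ≡ 1 ∷ u'
  front-equal = γ-injective q q' λ i j t →
    trans (γ-from-V₀ u q i j t) (trans (δ₁-cong V≡V'₁ t) (sym (γ-from-V₀ u' q' i j t)))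

-- Surjectivity

module InsertionSort (_◁_ : ℕ → ℕ → Bool) (L : ℕ → Set)
  (◁-flip : ∀ {a b} → a ≢ b → b ◁ a ≡ not (a ◁ b))
  (◁-trans : ∀ {a b c} → L a → L b → L c → a ◁ b ≡ true → b ◁ c ≡ true → a ◁ c ≡ true)
  where

  insert : ℕ → List ℕ → List ℕ
  insert a [] = [ a ]
  insert a (x ∷ xs) = if a ◁ x then a ∷ x ∷ xs else x ∷ insert a xs

  sort : List ℕ → List ℕ
  sort = foldr insert []

  insert-↭ : ∀ a xs → insert a xs ↭ a ∷ xs
  insert-↭ a [] = ↭-refl
  insert-↭ a (x ∷ xs) with a ◁ x
  ... | true = ↭-refl
  ... | false = ↭-trans (↭-prep x (insert-↭ a xs)) (↭-swap x a ↭-refl)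

  sort-↭ : ∀ xs → sort xs ↭ xs
  sort-↭ [] = ↭-refl
  sort-↭ (a ∷ xs) = ↭-trans (insert-↭ a (sort xs)) (↭-prep a (sort-↭ xs))

  Sorted : List ℕ → Set
  Sorted = AllPairs (λ a b → a ◁ b ≡ true)

  insert-sorted : ∀ {a xs} → L a → All L xs → a ∉ xs → Sorted xs → Sorted (insert a xs)
  insert-sorted {a} {[]} _ _ _ _ = [] ∷ []
  insert-sorted {a} {x ∷ xs} La (Lx ∷ Lxs) a∉ (x◁xs ∷ sorted) with a ◁ x in a◁x
  ... | true = (a◁x ∷ All.zipWith (λ (Ly , x◁y) → ◁-trans La Lx Ly a◁x x◁y) (Lxs , x◁xs)) ∷ x◁xs ∷ sorted
  ... | false = ↭ₚ.All-resp-↭ (↭-sym (insert-↭ a xs)) (x◁a ∷ x◁xs) ∷ insert-sorted La Lxs (a∉ ∘ there) sorted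
    where
    x◁a : x ◁ a ≡ true
    x◁a = trans (◁-flip (a∉ ∘ here)) (cong not a◁x)

  sort-sorted : ∀ {xs} → All L xs → Unique xs → Sorted (sort xs)
  sort-sorted {[]} _ _ = []
  sort-sorted {a ∷ xs} (La ∷ Lxs) u =
    insert-sorted La (↭ₚ.All-resp-↭ (↭-sym (sort-↭ xs)) Lxs) (∉-head u ∘ ↭ₚ.∈-resp-↭ (sort-↭ xs))
      (sort-sorted Lxs (AllPairs.tail u))

  before-sorted : ∀ {a b} xs → Sorted xs → before a b xs ≡ true → a ◁ b ≡ true
  before-sorted {a} {b} (x ∷ xs) (x◁xs ∷ sorted) ab with x ≟ a
  ... | yes refl = All.lookup x◁xs (mem⇒∈ xs (trans (sym (before-head x b xs)) ab))
  ... | no x≢a = before-sorted xs sorted (trans (sym (before-∷ xs x≢a)) ab)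

  before-sort : ∀ {a b xs} → All L xs → Unique xs → a ∈ xs → b ∈ xs → a ≢ b → before a b (sort xs) ≡ a ◁ b
  before-sort {a} {b} {xs} Lxs u a∈ b∈ a≢b with before a b (sort xs) in ab
  ... | true = sym (before-sorted (sort xs) (sort-sorted Lxs u) ab)
  ... | false = trans (sym (cong not (before-sorted (sort xs) (sort-sorted Lxs u) ba))) (sym (◁-flip (a≢b ∘ sym)))
    where
    ba : before b a (sort xs) ≡ true
    ba = before-flip (Unique-resp-↭ (↭-sym (sort-↭ xs)) u) a≢b
           (↭ₚ.∈-resp-↭ (↭-sym (sort-↭ xs)) a∈) (↭ₚ.∈-resp-↭ (↭-sym (sort-↭ xs)) b∈) ab

-- t i j (for i < j) says whether j is to precede i; its two hypotheses say that t
-- is the inversion set of a total order.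
module InversionOrder (t : ℕ → ℕ → Bool) (L : ℕ → Set)
  (t-up : ∀ {i j k} → L i → L j → L k → i < j → j < k → t i j ≡ false → t j k ≡ false → t i k ≡ false)
  (t-down : ∀ {i j k} → L i → L j → L k → i < j → j < k → t i j ≡ true → t j k ≡ true → t i k ≡ true)
  where

  _◁_ : ℕ → ℕ → Bool
  a ◁ b with ℕₚ.<-cmp a b
  ... | tri< _ _ _ = not (t a b)
  ... | tri≈ _ _ _ = false
  ... | tri> _ _ _ = t b a

  ◁-< : ∀ {a b} → a < b → a ◁ b ≡ not (t a b)
  ◁-< {a} {b} a<b with ℕₚ.<-cmp a b
  ... | tri< _ _ _ = refl
  ... | tri≈ a≮b _ _ = contradiction a<b a≮b
  ... | tri> a≮b _ _ = contradiction a<b a≮b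

  ◁-> : ∀ {a b} → b < a → a ◁ b ≡ t b a
  ◁-> {a} {b} b<a with ℕₚ.<-cmp a b
  ... | tri< _ _ b≮a = contradiction b<a b≮a
  ... | tri≈ _ _ b≮a = contradiction b<a b≮a
  ... | tri> _ _ _ = refl

  ◁-flip : ∀ {a b} → a ≢ b → b ◁ a ≡ not (a ◁ b)
  ◁-flip {a} {b} a≢b with ℕₚ.<-cmp a b
  ... | tri< a<b _ _ = trans (◁-> a<b) (sym (Boolₚ.not-involutive (t a b)))
  ... | tri≈ _ a≡b _ = contradiction a≡b a≢b
  ... | tri> _ _ b<a = ◁-< b<a

  ◁-irrefl : ∀ a → a ◁ a ≡ false
  ◁-irrefl a with ℕₚ.<-cmp a a
  ... | tri< a<a _ _ = contradiction a<a (ℕₚ.<-irrefl refl)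
  ... | tri≈ _ _ _ = refl
  ... | tri> _ _ a<a = contradiction a<a (ℕₚ.<-irrefl refl)

  ◁-asym : ∀ {a b} → a ◁ b ≡ true → b ◁ a ≡ false
  ◁-asym {a} {b} = by-cases (a ≟ b)
    where
    by-cases : ∀ {a b} → Dec (a ≡ b) → a ◁ b ≡ true → b ◁ a ≡ false
    by-cases {a} (yes refl) ab = contradiction (trans (sym ab) (◁-irrefl a)) λ ()
    by-cases (no a≢b) ab = trans (◁-flip a≢b) (cong not ab)

  private
    not-true : ∀ {x} → not x ≡ true → x ≡ false
    not-true = Boolₚ.not-injective

    contra : ∀ {x} {A : Set} → x ≡ false → x ≡ true → A
    contra x≡false x≡true = contradiction (trans (sym x≡false) x≡true) λ ()

    ◁-trans-by-order : ∀ {a b c} →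
                       Tri (a < b) (a ≡ b) (b < a) → Tri (b < c) (b ≡ c) (c < b) → Tri (a < c) (a ≡ c) (c < a) →
                       L a → L b → L c → a ◁ b ≡ true → b ◁ c ≡ true → a ◁ c ≡ true
    ◁-trans-by-order {a} (tri≈ _ refl _) _ _ _ _ _ ab bc = contra (◁-irrefl a) ab
    ◁-trans-by-order {b = b} _ (tri≈ _ refl _) _ _ _ _ ab bc = contra (◁-irrefl b) bc
    ◁-trans-by-order {a} {b} _ _ (tri≈ _ refl _) _ _ _ ab bc = contra (◁-asym {a} {b} ab) bc
    ◁-trans-by-order (tri< a<b _ _) (tri< b<c _ _) (tri< a<c _ _) La Lb Lc ab bc
      rewrite ◁-< a<b | ◁-< b<c | ◁-< a<c = cong not (t-up La Lb Lc a<b b<c (not-true ab) (not-true bc))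
    ◁-trans-by-order (tri< a<b _ _) (tri> _ _ c<b) (tri< a<c _ _) La Lb Lc ab bc
      rewrite ◁-< a<b | ◁-> c<b | ◁-< a<c =
      cong not (Boolₚ.¬-not λ tac → contra (not-true ab) (t-down La Lc Lb a<c c<b tac bc))
    ◁-trans-by-order (tri< a<b _ _) (tri> _ _ c<b) (tri> _ _ c<a) La Lb Lc ab bc
      rewrite ◁-< a<b | ◁-> c<b | ◁-> c<a =
      Boolₚ.¬-not λ tca → contra (t-up Lc La Lb c<a a<b tca (not-true ab)) bc
    ◁-trans-by-order (tri> _ _ b<a) (tri< b<c _ _) (tri< a<c _ _) La Lb Lc ab bc
      rewrite ◁-> b<a | ◁-< b<c | ◁-< a<c =
      cong not (Boolₚ.¬-not λ tac → contra (not-true bc) (t-down Lb La Lc b<a a<c ab tac))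
    ◁-trans-by-order (tri> _ _ b<a) (tri< b<c _ _) (tri> _ _ c<a) La Lb Lc ab bc
      rewrite ◁-> b<a | ◁-< b<c | ◁-> c<a =
      Boolₚ.¬-not λ tca → contra (t-up Lb Lc La b<c c<a (not-true bc) tca) ab
    ◁-trans-by-order (tri> _ _ b<a) (tri> _ _ c<b) (tri> _ _ c<a) La Lb Lc ab bc
      rewrite ◁-> b<a | ◁-> c<b | ◁-> c<a = t-down Lc Lb La c<b b<a bc ab
    ◁-trans-by-order (tri< a<b _ _) (tri< b<c _ _) (tri> _ _ c<a) _ _ _ _ _ =
      contradiction (ℕₚ.<-trans a<b b<c) (ℕₚ.<-asym c<a)
    ◁-trans-by-order (tri> _ _ b<a) (tri> _ _ c<b) (tri< a<c _ _) _ _ _ _ _ =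
      contradiction (ℕₚ.<-trans c<b b<a) (ℕₚ.<-asym a<c)

  ◁-trans : ∀ {a b c} → L a → L b → L c → a ◁ b ≡ true → b ◁ c ≡ true → a ◁ c ≡ true
  ◁-trans {a} {b} {c} = ◁-trans-by-order (ℕₚ.<-cmp a b) (ℕₚ.<-cmp b c) (ℕₚ.<-cmp a c)

Bit-defect-up : ∀ {x y z} → Bit (indicator x + indicator y - indicator z) → x ≡ false → y ≡ false → z ≡ false
Bit-defect-up {z = false} _ _ _ = refl
Bit-defect-up {z = true} (inj₁ ()) refl refl
Bit-defect-up {z = true} (inj₂ ()) refl refl

Bit-defect-down : ∀ {x y z} → Bit (indicator x + indicator y - indicator z) → x ≡ true → y ≡ true → z ≡ true
Bit-defect-down {z = true} _ _ _ = refl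
Bit-defect-down {z = false} (inj₁ ()) refl refl
Bit-defect-down {z = false} (inj₂ ()) refl refl

isOne : ℤ → Bool
isOne (+ 1) = true
isOne _ = false

indicator-isOne : ∀ {x} → Bit x → indicator (isOne x) ≡ x
indicator-isOne (inj₁ refl) = refl
indicator-isOne (inj₂ refl) = refl

δ-cocycle : ∀ v i j k → δ v 1 i j + δ v 1 j k - δ v 1 i k ≡ δ v i j k
δ-cocycle v i j k = cocycle (diag0 v 1 i) (diag0 v 1 j) (diag0 v 1 k) (diag0 v i j) (diag0 v j k) (diag0 v i k)
  where
  cocycle : ∀ a₁ᵢ a₁ⱼ a₁ₖ aᵢⱼ aⱼₖ aᵢₖ →
            (a₁ⱼ - a₁ᵢ - aᵢⱼ) + (a₁ₖ - a₁ⱼ - aⱼₖ) - (a₁ₖ - a₁ᵢ - aᵢₖ) ≡ aᵢₖ - aᵢⱼ - aⱼₖ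
  cocycle = solve-∀

δ-Bit : ∀ {n v} → Admitted n v → ∀ {i j k} → 1 ≤ i → i < j → j < k → k ≤ n → Bit (δ v i j k)
δ-Bit {v = v} (_ , _ , triangle) {i} {j} {k} 1≤i i<j j<k k≤n
  rewrite δ-off-diagonal v i<j j<k with triangle i j k 1≤i i<j j<k k≤n
... | lower , upper = 0≤∧≤1⇒Bit
  (subst (+ 0 ≤ℤ_) (sym (sub-sub (v i k) (v i j) (v j k))) (ℤₚ.i≤j⇒0≤j-i lower))
  (subst (_≤ℤ + 1) (sym (sub-sub (v i k) (v i j) (v j k)))
    (subst (v i k - (v i j + v j k) ≤ℤ_) (add-sub (v i j + v j k) (+ 1)) (ℤₚ.+-monoˡ-≤ (- (v i j + v j k)) upper)))
  where
  sub-sub : ∀ a b c → a - b - c ≡ a - (b + c)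
  sub-sub = solve-∀
  add-sub : ∀ s x → s + x - s ≡ x
  add-sub = solve-∀

δ₁-Bit : ∀ {n v} → Admitted n v → ∀ {i j} → InT n i j → Bit (δ v 1 i j)
δ₁-Bit {v = v} adm {i} {j} (1≤i , i<j , j≤n) with i ≟ 1
... | yes refl = inj₁ (cancel (diag0 v 1 j))
  where
  cancel : ∀ x → x - + 0 - x ≡ + 0
  cancel = solve-∀
... | no i≢1 = δ-Bit adm ℕₚ.≤-refl (ℕₚ.≤∧≢⇒< 1≤i (i≢1 ∘ sym)) i<j j≤n

-- The word realising an admitted v: its γ must be δ v 1 _ _ by γ-from-V₀, and
-- these values are the inversions of a total order on the letters.
module Realise {n v} (adm : Admitted n v) where

  private
    t : ℕ → ℕ → Bool
    t i j = isOne (δ v 1 i j)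

    indicator-t : ∀ {i j} → InT n i j → indicator (t i j) ≡ δ v 1 i j
    indicator-t = indicator-isOne ∘ δ₁-Bit adm

    t-defect-Bit : ∀ {i j k} → Letter n i → Letter n j → Letter n k → i < j → j < k →
                   Bit (indicator (t i j) + indicator (t j k) - indicator (t i k))
    t-defect-Bit {i} {j} {k} (1≤i , _) (1≤j , j≤n) (_ , k≤n) i<j j<k =
      subst Bit (sym (trans (cong₃ (λ x y z → x + y - z)
                               (indicator-t (1≤i , i<j , j≤n)) (indicator-t (1≤j , j<k , k≤n))
                               (indicator-t (1≤i , ℕₚ.<-trans i<j j<k , k≤n)))
                      (δ-cocycle v i j k)))
        (δ-Bit adm 1≤i i<j j<k k≤n)

  open InversionOrder t (Letter n)
    (λ Li Lj Lk i<j j<k → Bit-defect-up (t-defect-Bit Li Lj Lk i<j j<k))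
    (λ Li Lj Lk i<j j<k → Bit-defect-down (t-defect-Bit Li Lj Lk i<j j<k))
  open InsertionSort _◁_ (Letter n) ◁-flip ◁-trans

  word : List ℕ
  word = sort (letters n)

  word-perm : IsPerm n word
  word-perm = sort-↭ (letters n)

  γ-word : ∀ {i j} → InT n i j → γ i j word ≡ δ v 1 i j
  γ-word {i} {j} (1≤i , i<j , j≤n) = begin
    indicator (before j i word) ≡⟨ cong indicator (before-sort (All.tabulate ∈-letters⁻) (letters-unique n)
                                     (∈-letters⁺ (1≤j , j≤n)) (∈-letters⁺ (1≤i , i≤n)) (ℕₚ.>⇒≢ i<j)) ⟩
    indicator (j ◁ i)           ≡⟨ cong indicator (◁-> i<j) ⟩
    indicator (t i j)           ≡⟨ indicator-t (1≤i , i<j , j≤n) ⟩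
    δ v 1 i j                   ∎
    where
    open ≡-Reasoning
    i≤n = ℕₚ.≤-trans (ℕₚ.<⇒≤ i<j) j≤n
    1≤j = ℕₚ.≤-trans 1≤i (ℕₚ.<⇒≤ i<j)

  V₀-word : EqT n (V₀ word) v
  V₀-word = EqT-by-columns (λ i 1≤i si≤n → trans (V₀-diag word i) (sym (proj₁ (proj₂ adm) i 1≤i si≤n))) step
    where
    step : ∀ i j → 1 ≤ i → i < j → suc j ≤ n → V₀ word i j ≡ v i j → V₀ word i (suc j) ≡ v i (suc j)
    step i j 1≤i i<j sj≤n V≡v = begin
      V₀ word i (suc j)                             ≡⟨ V₀-suc word (ℕₚ.<⇒≤ i<j) ⟩
      V₀ word i j + defect word i j (suc j)          ≡⟨ cong₂ _+_ V≡v (cong₃ (λ x y z → x + y - z)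
                                                         (γ-word (1≤i , i<j , j≤n)) (γ-word (1≤j , ℕₚ.n<1+n j , sj≤n))
                                                         (γ-word (1≤i , ℕₚ.<-trans i<j (ℕₚ.n<1+n j) , sj≤n))) ⟩
      v i j + (δ v 1 i j + δ v 1 j (suc j) - δ v 1 i (suc j)) ≡⟨ cong (_+_ (v i j)) (trans (δ-cocycle v i j (suc j))
                                                                   (δ-off-diagonal v i<j (ℕₚ.n<1+n j))) ⟩
      v i j + (v i (suc j) - v i j - v j (suc j))    ≡⟨ cong (λ x → v i j + (v i (suc j) - v i j - x))
                                                         (proj₁ (proj₂ adm) j 1≤j sj≤n) ⟩
      v i j + (v i (suc j) - v i j - + 0)            ≡⟨ cancel (v i j) (v i (suc j)) ⟩
      v i (suc j)                                   ∎
      where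
      open ≡-Reasoning
      j≤n = ℕₚ.<⇒≤ sj≤n
      1≤j = ℕₚ.≤-trans 1≤i (ℕₚ.<⇒≤ i<j)
      cancel : ∀ a b → a + (b - a - + 0) ≡ b
      cancel = solve-∀

V₀-surjective : ∀ {n} v → Admitted n v → ∃[ w ] (IsPerm n w × EqT n (V₀ w) v)
V₀-surjective v adm = word , word-perm , V₀-word
  where open Realise adm

-- Steps raise one coordinate

γ-swap : ∀ {i j r s} xs → r < s → i < j → ¬ (i ≡ r × j ≡ s) → γ i j (r ∷ s ∷ xs) ≡ γ i j (s ∷ r ∷ xs)
γ-swap xs r<s i<j ij≢rs = cong indicator (sym (before-swap xs (ℕₚ.<⇒≢ r<s)
  (λ (j≡s , i≡r) → ij≢rs (i≡r , j≡s)) (λ (j≡r , i≡s) → ℕₚ.<-asym r<s (subst₂ _<_ i≡s j≡r i<j))))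

γ⁺-swap : ∀ {r s} xs → suc r < s → ∀ k → γ⁺ (r ∷ s ∷ xs) k ≡ γ⁺ (s ∷ r ∷ xs) k
γ⁺-swap xs sr<s k = γ-swap xs (ℕₚ.<-trans (ℕₚ.n<1+n _) sr<s) (ℕₚ.n<1+n k)
  (λ (k≡r , sk≡s) → ℕₚ.<⇒≢ sr<s (trans (cong suc (sym k≡r)) sk≡s))

V₀-swap : ∀ {i j r s} xs → suc r < s → i < j → ¬ (i ≡ r × j ≡ s) →
          V₀ (r ∷ s ∷ xs) i j ≡ V₀ (s ∷ r ∷ xs) i j
V₀-swap {i} {j} xs sr<s i<j ij≢rs = cong₂ (λ x y → - x + y)
  (γ-swap xs (ℕₚ.<-trans (ℕₚ.n<1+n _) sr<s) i<j ij≢rs) (sumRange-cong i j (γ⁺-swap xs sr<s))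

V₀-swap-pair : ∀ {r s} xs → suc r < s → r ∉ xs → V₀ (r ∷ s ∷ xs) r s ≡ V₀ (s ∷ r ∷ xs) r s + + 1
V₀-swap-pair {r} {s} xs sr<s r∉xs = begin
  - γ r s (r ∷ s ∷ xs) + sumRange r s (γ⁺ (r ∷ s ∷ xs))  ≡⟨ cong₂ (λ x y → - x + y) γ-before (sumRange-cong r s (γ⁺-swap xs sr<s)) ⟩
  - + 0 + sumRange r s (γ⁺ (s ∷ r ∷ xs))                 ≡⟨ shift (sumRange r s (γ⁺ (s ∷ r ∷ xs))) ⟩
  - + 1 + sumRange r s (γ⁺ (s ∷ r ∷ xs)) + + 1           ≡⟨ cong (λ x → - x + sumRange r s (γ⁺ (s ∷ r ∷ xs)) + + 1) (sym γ-after) ⟩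
  V₀ (s ∷ r ∷ xs) r s + + 1                              ∎
  where
  open ≡-Reasoning
  γ-before : γ r s (r ∷ s ∷ xs) ≡ + 0
  γ-before = cong indicator (trans (before-∷ (s ∷ xs) (ℕₚ.<⇒≢ (ℕₚ.<-trans (ℕₚ.n<1+n r) sr<s)))
                              (trans (before-head s r xs) (mem-∉ xs r∉xs)))
  γ-after : γ r s (s ∷ r ∷ xs) ≡ + 1
  γ-after = cong indicator (trans (before-head s r (r ∷ xs)) (mem-∈ {r} {r ∷ xs} (here refl)))
  shift : ∀ x → - + 0 + x ≡ - + 1 + x + + 1
  shift = solve-∀

LeT-trans : ∀ {n v v' v''} → LeT n v v' → LeT n v' v'' → LeT n v v''
LeT-trans v≤v' v'≤v'' i j t = ℤₚ.≤-trans (v≤v' i j t) (v'≤v'' i j t)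

EqT⇒LeT : ∀ {n v v'} → EqT n v v' → LeT n v v'
EqT⇒LeT v≡v' i j t = ℤₚ.≤-reflexive (v≡v' i j t)

EqT-sym : ∀ {n v v'} → EqT n v v' → EqT n v' v
EqT-sym v≡v' i j t = sym (v≡v' i j t)

V₀-swap-≤ : ∀ {n r s} xs → suc r < s → r ∉ xs → LeT n (V₀ (s ∷ r ∷ xs)) (V₀ (r ∷ s ∷ xs))
V₀-swap-≤ {r = r} {s} xs sr<s r∉xs i j (_ , i<j , _) with i ≟ r | j ≟ s
... | yes refl | yes refl = ℤₚ.≤-trans (ℤₚ.i≤i+j _ (+ 1)) (ℤₚ.≤-reflexive (sym (V₀-swap-pair xs sr<s r∉xs)))
... | yes refl | no j≢s = ℤₚ.≤-reflexive (sym (V₀-swap xs sr<s i<j (j≢s ∘ proj₂)))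
... | no i≢r | _ = ℤₚ.≤-reflexive (sym (V₀-swap xs sr<s i<j (i≢r ∘ proj₁)))

Step-perm : ∀ {n w w'} → IsPerm n w → Step w w' → IsPerm n w'
Step-perm p (s , r , xs , _ , rot , rot') = rotate-perm (↭-trans (↭-swap r s ↭-refl) (rotate-perm p rot)) (Rot-sym rot')

V₀-Step : ∀ {n w w'} → IsPerm n w → Step w w' → LeT n (V₀ w) (V₀ w')
V₀-Step {n} p st@(s , r , xs , sr<s , rot , rot') =
  LeT-trans {n} (EqT⇒LeT {n} (V₀-rotate p rot))
    (LeT-trans {n} (V₀-swap-≤ xs sr<s r∉xs) (EqT⇒LeT {n} (EqT-sym {n} (V₀-rotate (Step-perm p st) rot'))))
  where
  r∉xs : r ∉ xs
  r∉xs = ∉-head (AllPairs.tail (perm-unique (rotate-perm p rot)))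

V₀-monotone : ∀ {n w w'} → IsPerm n w → CircLe w w' → LeT n (V₀ w) (V₀ w')
V₀-monotone p ε i j t = ℤₚ.≤-refl
V₀-monotone {n} p (inj₁ rot ◅ rest) =
  LeT-trans {n} (EqT⇒LeT {n} (V₀-rotate p rot)) (V₀-monotone (rotate-perm p rot) rest)
V₀-monotone {n} p (inj₂ st ◅ rest) = LeT-trans {n} (V₀-Step p st) (V₀-monotone (Step-perm p st) rest)

-- Gradings

sumℤ-++ : ∀ xs ys → sumℤ (xs ++ ys) ≡ sumℤ xs + sumℤ ys
sumℤ-++ [] ys = sym (ℤₚ.+-identityˡ _)
sumℤ-++ (x ∷ xs) ys = trans (cong (_+_ x) (sumℤ-++ xs ys)) (sym (ℤₚ.+-assoc x _ _))

sumℤ-concatMap : ∀ {A B : Set} (h : B → ℤ) (g : A → List B) xs →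
                 sumℤ (map h (concatMap g xs)) ≡ sumℤ (map (λ x → sumℤ (map h (g x))) xs)
sumℤ-concatMap h g [] = refl
sumℤ-concatMap h g (x ∷ xs) = begin
  sumℤ (map h (g x ++ concatMap g xs))              ≡⟨ cong sumℤ (Listₚ.map-++ h (g x) (concatMap g xs)) ⟩
  sumℤ (map h (g x) ++ map h (concatMap g xs))      ≡⟨ sumℤ-++ (map h (g x)) _ ⟩
  sumℤ (map h (g x)) + sumℤ (map h (concatMap g xs)) ≡⟨ cong (_+_ (sumℤ (map h (g x)))) (sumℤ-concatMap h g xs) ⟩
  sumℤ (map (λ x → sumℤ (map h (g x))) (x ∷ xs))    ∎
  where open ≡-Reasoning

sumT≡sumTo : ∀ n f → sumT n f ≡ sumTo (λ j → sumTo (λ i → f (suc i) (suc j)) j) n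
sumT≡sumTo n f = trans (sumℤ-concatMap _ (λ j → map (λ i → (suc i , suc j)) (upTo j)) (upTo n))
  (trans (sumℤ-map-applyUpTo _ id n)
    (sumTo-cong n (λ j _ → trans (cong sumℤ (sym (Listₚ.map-∘ (upTo j)))) (sumℤ-map-applyUpTo _ id j))))

sumT-+ : ∀ n f g → sumT n (λ i j → f i j + g i j) ≡ sumT n f + sumT n g
sumT-+ n f g = begin
  sumT n (λ i j → f i j + g i j)                                      ≡⟨ sumT≡sumTo n _ ⟩
  sumTo (λ j → sumTo (λ i → f (suc i) (suc j) + g (suc i) (suc j)) j) n ≡⟨ sumTo-cong n (λ j _ →
                                                                          sumTo-+ (λ i → f (suc i) (suc j)) (λ i → g (suc i) (suc j)) j) ⟩
  sumTo (λ j → row f j + row g j) n                                    ≡⟨ sumTo-+ (row f) (row g) n ⟩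
  sumTo (row f) n + sumTo (row g) n                                    ≡⟨ sym (cong₂ _+_ (sumT≡sumTo n f) (sumT≡sumTo n g)) ⟩
  sumT n f + sumT n g                                                  ∎
  where
  open ≡-Reasoning
  row : (ℕ → ℕ → ℤ) → ℕ → ℤ
  row h j = sumTo (λ i → h (suc i) (suc j)) j

sumT-neg : ∀ n f → sumT n (λ i j → - f i j) ≡ - sumT n f
sumT-neg n f = trans (sumT≡sumTo n _) (trans
  (trans (sumTo-cong n (λ j _ → sumTo-neg (λ i → f (suc i) (suc j)) j)) (sumTo-neg _ n))
  (cong -_ (sym (sumT≡sumTo n f))))

sumT-mono : ∀ {n f g} → LeT n f g → sumT n f ≤ℤ sumT n g
sumT-mono {n} {f} {g} f≤g = subst₂ _≤ℤ_ (sym (sumT≡sumTo n f)) (sym (sumT≡sumTo n g))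
  (sumTo-mono _ _ n (λ j j<n → sumTo-mono _ _ j (λ i i<j → f≤g (suc i) (suc j) (s≤s z≤n , s≤s i<j , j<n))))

sumT-mono-< : ∀ {n f g} → LeT n f g → ∀ {a b} → InT n a b → f a b <ℤ g a b → sumT n f <ℤ sumT n g
sumT-mono-< {n} {f} {g} f≤g {suc a} {suc b} (_ , s≤s a<b , b<n) fab<gab =
  subst₂ _<ℤ_ (sym (sumT≡sumTo n f)) (sym (sumT≡sumTo n g))
    (sumTo-mono-< _ _ n (λ j j<n → sumTo-mono _ _ j (λ i i<j → f≤g (suc i) (suc j) (s≤s z≤n , s≤s i<j , j<n))) b b<n
      (sumTo-mono-< _ _ b (λ i i<b → f≤g (suc i) (suc b) (s≤s z≤n , s≤s i<b , b<n)) a a<b fab<gab))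

module TriangleSum (d : ℕ → ℤ) where

  interval : ℕ → ℕ → ℤ
  interval i j = sumTo (λ t → d (i ℕ.+ t)) (j ∸ i)

  interval-suc : ∀ {i j} → i ≤ j → interval i (suc j) ≡ interval i j + d j
  interval-suc {i} {j} i≤j = begin
    sumTo (λ t → d (i ℕ.+ t)) (suc j ∸ i)          ≡⟨ cong (sumTo _) (ℕₚ.+-∸-assoc 1 i≤j) ⟩
    sumTo (λ t → d (i ℕ.+ t)) (suc (j ∸ i))        ≡⟨ sumTo-suc _ (j ∸ i) ⟩
    interval i j + d (i ℕ.+ (j ∸ i))               ≡⟨ cong (λ m → interval i j + d m) (ℕₚ.m+[n∸m]≡n i≤j) ⟩
    interval i j + d j                             ∎
    where open ≡-Reasoning

  interval-diag : ∀ j → interval j (suc j) ≡ d j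
  interval-diag j rewrite ℕₚ.m+n∸n≡m 1 j | ℕₚ.+-identityʳ j = ℤₚ.+-identityʳ (d j)

  linear : ℕ → ℤ
  linear t = + suc t * d t

  column-sum : ∀ m → sumTo (λ i → interval i m) m ≡ sumTo linear m
  column-sum zero = refl
  column-sum (suc m) = begin
    sumTo (λ i → interval i (suc m)) (suc m)                   ≡⟨ sumTo-suc _ m ⟩
    sumTo (λ i → interval i (suc m)) m + interval m (suc m)    ≡⟨ cong₂ _+_ (sumTo-cong m (λ i i<m → interval-suc (ℕₚ.<⇒≤ i<m)))
                                                                    (interval-diag m) ⟩
    sumTo (λ i → interval i m + d m) m + d m                   ≡⟨ cong (_+ d m) (sumTo-+ (λ i → interval i m) (λ _ → d m) m) ⟩
    sumTo (λ i → interval i m) m + sumTo (λ _ → d m) m + d m   ≡⟨ cong₂ (λ x y → x + y + d m) (column-sum m) (sumTo-const (d m) m) ⟩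
    sumTo linear m + + m * d m + d m                           ≡⟨ regroup (sumTo linear m) (+ m) (d m) ⟩
    sumTo linear m + linear m                                  ≡⟨ sym (sumTo-suc linear m) ⟩
    sumTo linear (suc m)                                       ∎
    where
    open ≡-Reasoning
    regroup : ∀ a k x → a + k * x + x ≡ a + (+ 1 + k) * x
    regroup = solve-∀

  quadratic : ℕ → ℕ → ℤ
  quadratic n t = + (suc t ℕ.* (n ∸ suc t)) * d t

  quadratic-suc : ∀ {n t} → t < n → quadratic n t + linear t ≡ quadratic (suc n) t
  quadratic-suc {n} {t} t<n = trans (collect (+ (suc t ℕ.* (n ∸ suc t))) (+ suc t) (d t))
    (cong (_* d t) (trans (sym (ℤₚ.pos-+ (suc t ℕ.* (n ∸ suc t)) (suc t))) (cong +_ (begin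
      suc t ℕ.* (n ∸ suc t) ℕ.+ suc t  ≡⟨ ℕₚ.+-comm _ (suc t) ⟩
      suc t ℕ.+ suc t ℕ.* (n ∸ suc t)  ≡⟨ sym (ℕₚ.*-suc (suc t) (n ∸ suc t)) ⟩
      suc t ℕ.* suc (n ∸ suc t)       ≡⟨ cong (suc t ℕ.*_) (sym (ℕₚ.+-∸-assoc 1 t<n)) ⟩
      suc t ℕ.* (suc n ∸ suc t)       ∎))))
    where
    open ≡-Reasoning
    collect : ∀ a b x → a * x + b * x ≡ (a + b) * x
    collect = solve-∀

  quadratic-last : ∀ n → quadratic (suc n) n ≡ + 0
  quadratic-last n rewrite ℕₚ.n∸n≡0 n | ℕₚ.*-zeroʳ n = ℤₚ.*-zeroˡ (d n)

  sumTo-quadratic-suc : ∀ n → sumTo (quadratic (suc n)) (suc n) ≡ sumTo (quadratic (suc n)) n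
  sumTo-quadratic-suc n = trans (sumTo-suc (quadratic (suc n)) n)
    (trans (cong (_+_ (sumTo (quadratic (suc n)) n)) (quadratic-last n)) (ℤₚ.+-identityʳ _))

  -- each m is counted once for every pair i ≤ m < j < n, i.e. (m + 1)(n − 1 − m) times
  triangle-sum : ∀ n → sumTo (λ j → sumTo (λ i → interval i j) j) n ≡ sumTo (quadratic n) n
  triangle-sum zero = refl
  triangle-sum (suc n) = begin
    sumTo (λ j → sumTo (λ i → interval i j) j) (suc n)                          ≡⟨ sumTo-suc _ n ⟩
    sumTo (λ j → sumTo (λ i → interval i j) j) n + sumTo (λ i → interval i n) n ≡⟨ cong₂ _+_ (triangle-sum n) (column-sum n) ⟩
    sumTo (quadratic n) n + sumTo linear n                                     ≡⟨ sym (sumTo-+ (quadratic n) linear n) ⟩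
    sumTo (λ t → quadratic n t + linear t) n                                   ≡⟨ sumTo-cong n (λ t t<n → quadratic-suc t<n) ⟩
    sumTo (quadratic (suc n)) n                                                ≡⟨ sym (sumTo-quadratic-suc n) ⟩
    sumTo (quadratic (suc n)) (suc n)                                          ∎
    where open ≡-Reasoning

sumT-sumRange : ∀ n c → sumT n (λ i j → sumRange i j c) ≡ sumRange 1 n (λ k → + (k ℕ.* (n ∸ k)) * c k)
sumT-sumRange zero c = refl
sumT-sumRange (suc n) c = begin
  sumT (suc n) (λ i j → sumRange i j c)                          ≡⟨ sumT≡sumTo (suc n) _ ⟩
  sumTo (λ j → sumTo (λ i → sumRange (suc i) (suc j) c) j) (suc n) ≡⟨ sumTo-cong (suc n) (λ j _ →
                                                                      sumTo-cong j (λ i _ → sumRange≡sumTo (suc i) (suc j) c)) ⟩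
  sumTo (λ j → sumTo (λ i → interval i j) j) (suc n)              ≡⟨ triangle-sum (suc n) ⟩
  sumTo (quadratic (suc n)) (suc n)                               ≡⟨ sumTo-quadratic-suc n ⟩
  sumTo (quadratic (suc n)) n                                     ≡⟨ sym (sumRange≡sumTo 1 (suc n) (λ k → + (k ℕ.* (suc n ∸ k)) * c k)) ⟩
  sumRange 1 (suc n) (λ k → + (k ℕ.* (suc n ∸ k)) * c k)          ∎
  where
  open ≡-Reasoning
  open TriangleSum (c ∘ suc)

V₀-grading : ∀ n w → N n w ≡ gradeV n (V₀ w)
V₀-grading n w = sym (begin
  sumT n (λ i j → - γ i j w + sumRange i j (γ⁺ w))                    ≡⟨ sumT-+ n _ _ ⟩
  sumT n (λ i j → - γ i j w) + sumT n (λ i j → sumRange i j (γ⁺ w))   ≡⟨ cong₂ _+_ (sumT-neg n _) (sumT-sumRange n (γ⁺ w)) ⟩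
  - sumT n (λ i j → γ i j w) + weighted                              ≡⟨ ℤₚ.+-comm (- sumT n (λ i j → γ i j w)) weighted ⟩
  N n w                                                              ∎)
  where
  open ≡-Reasoning
  weighted = sumRange 1 n (λ k → + (k ℕ.* (n ∸ k)) * γ⁺ w k)

-- Climbing from V₀ w to an admitted vector above it

squeeze : ∀ {a a' b b'} → a ≤ℤ a' → b ≤ℤ b' → a' + b' ≤ℤ a + b → a ≡ a' × b ≡ b'
squeeze a≤a' b≤b' sum≤ =
  ℤₚ.≤-antisym a≤a' (ℤₚ.≮⇒≥ λ a<a' → ℤₚ.<⇒≱ (ℤₚ.+-mono-<-≤ a<a' b≤b') sum≤) ,
  ℤₚ.≤-antisym b≤b' (ℤₚ.≮⇒≥ λ b<b' → ℤₚ.<⇒≱ (ℤₚ.+-mono-≤-< a≤a' b<b') sum≤)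

before-split : ∀ {x y} xs ys → Unique (xs ++ x ∷ ys) → y ∈ ys → before x y (xs ++ x ∷ ys) ≡ true
before-split {x} {y} [] ys _ y∈ = trans (before-head x y ys) (mem-∈ y∈)
before-split {x} (h ∷ xs) ys u y∈ = trans (before-∷ (xs ++ x ∷ ys) h≢x) (before-split xs ys (AllPairs.tail u) y∈)
  where
  h≢x : h ≢ x
  h≢x h≡x = ∉-head u (subst (_∈ xs ++ x ∷ ys) (sym h≡x) (∈ₚ.∈-++⁺ʳ xs (here refl)))

⊎-∀-bounded : ∀ {A : Set} {P : ℕ → Set} n →
              (∀ i → 1 ≤ i → i ≤ n → A ⊎ P i) → A ⊎ (∀ i → 1 ≤ i → i ≤ n → P i)
⊎-∀-bounded zero _ = inj₂ λ { i 1≤i i≤0 → contradiction (ℕₚ.≤-trans 1≤i i≤0) λ () }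
⊎-∀-bounded (suc n) h
  with ⊎-∀-bounded n (λ i 1≤i i≤n → h i 1≤i (ℕₚ.m≤n⇒m≤1+n i≤n)) | h (suc n) (s≤s z≤n) ℕₚ.≤-refl
... | inj₁ a | _ = inj₁ a
... | inj₂ _ | inj₁ a = inj₁ a
... | inj₂ below | inj₂ top = inj₂ λ i 1≤i i≤sn → case ℕₚ.m≤n⇒m<n∨m≡n i≤sn of λ
  { (inj₁ (s≤s i≤n)) → below i 1≤i i≤n
  ; (inj₂ refl) → top }

factor-InT : ∀ {n w s r u} → IsPerm n w → Rot w (s ∷ r ∷ u) → r < s → InT n r s
factor-InT p rot r<s = proj₁ (perm-letter p' (there (here refl))) , r<s , proj₂ (perm-letter p' (here refl))
  where p' = rotate-perm p rot

budget-step : ∀ {x a b} k → x ≤ℤ a + + suc k → a <ℤ b → x ≤ℤ b + + k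
budget-step {x} {a} {b} k x≤a+sk a<b = ℤₚ.≤-trans x≤a+sk
  (subst (_≤ℤ b + + k) (sym (shift a (+ k))) (ℤₚ.+-monoˡ-≤ (+ k) (ℤₚ.i<j⇒suc[i]≤j a<b)))
  where
  shift : ∀ a b → a + (+ 1 + b) ≡ (+ 1 + a) + b
  shift = solve-∀

module Climb {n v} (adm : Admitted n v) where

  private
    v-diag = proj₁ (proj₂ adm)
    triangle = proj₂ (proj₂ adm)

  -- a circular factor s r of w with s > r + 1 whose swap keeps V₀ below v
  Raisable : List ℕ → Set
  Raisable w = ∃[ s ] ∃[ r ] ∃[ u ] (suc r < s × Rot w (s ∷ r ∷ u) × V₀ w r s <ℤ v r s)

  Raisable-rotate : ∀ {w w₀} → IsPerm n w → Rot w w₀ → Raisable w₀ → Raisable w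
  Raisable-rotate p rot (s , r , u , sr<s , rot₀ , V<v) = s , r , u , sr<s , rot' ,
    subst (_<ℤ v r s) (sym (V₀-rotate p rot r s (factor-InT p rot' (ℕₚ.<-trans (ℕₚ.n<1+n r) sr<s)))) V<v
    where rot' = Rot-trans rot rot₀

  adjacent : ∀ {w s r u} → IsPerm n w → LeT n (V₀ w) v → Rot w (s ∷ r ∷ u) → r < s → Raisable w ⊎ V₀ w r s ≡ v r s
  adjacent {w} {s} {r} {u} p V≤v rot r<s with V₀ w r s ℤₚ.<? v r s
  ... | no V≮v = inj₂ (ℤₚ.≤-antisym (V≤v r s (factor-InT p rot r<s)) (ℤₚ.≮⇒≥ V≮v))
  ... | yes V<v = inj₁ (s , r , u , ℕₚ.≤∧≢⇒< r<s sr≢s , rot , V<v)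
    where
    sr≢s : suc r ≢ s
    sr≢s refl = ℤₚ.<-irrefl (trans (V₀-diag w r) (sym (v-diag r 1≤r sr≤n))) V<v
      where
      1≤r = proj₁ (factor-InT p rot r<s)
      sr≤n = proj₂ (proj₂ (factor-InT p rot r<s))

  -- Row i of V₀ w is compared with v along w rotated to start with i, from right to left.
  module Row {i z} (p : IsPerm n (i ∷ z)) (V≤v : LeT n (V₀ (i ∷ z)) v) where

    private
      w₀ = i ∷ z
      V = V₀ w₀
      u = perm-unique p
      i∉z = ∉-head u
      1≤i = proj₁ (perm-letter p (here refl))

      letter : ∀ {m} → m ∈ z → Letter n m
      letter m∈ = perm-letter p (there m∈)

      ≢i : ∀ {m} → m ∈ z → m ≢ i
      ≢i m∈ m≡i = i∉z (subst (_∈ z) m≡i m∈)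

      γ-from-i : ∀ {m} → m ∈ z → γ i m w₀ ≡ + 0
      γ-from-i m∈ = γ-head z i∉z (≢i m∈)

      γ-to-i : ∀ {m} → m ∈ z → γ m i w₀ ≡ + 1
      γ-to-i {m} m∈ = cong indicator (trans (before-head i m z) (mem-∈ m∈))

      γ-forward : ∀ {x y} → before x y w₀ ≡ true → γ x y w₀ ≡ + 0
      γ-forward xy = cong indicator (before-asym u xy)

      γ-backward : ∀ {x y} → before x y w₀ ≡ true → γ y x w₀ ≡ + 1
      γ-backward xy = cong indicator xy

      split-with : ∀ {a b c} → a < b → b < c → ∀ {d} → defect w₀ a b c ≡ d → V a c ≡ V a b + V b c + d
      split-with a<b b<c refl = V₀-split w₀ (ℕₚ.<⇒≤ a<b) (ℕₚ.<⇒≤ b<c)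

    last-letter : ∀ {x rest} → Rot w₀ (x ∷ i ∷ rest) → Raisable w₀ ⊎ (i < x → V i x ≡ v i x)
    last-letter {x} rot with i ℕₚ.<? x
    ... | no i≮x = inj₂ (λ i<x → contradiction i<x i≮x)
    ... | yes i<x with adjacent p V≤v rot i<x
    ...   | inj₁ raisable = inj₁ raisable
    ...   | inj₂ V≡v = inj₂ (λ _ → V≡v)

    module _ {x y} (x∈ : x ∈ z) (y∈ : y ∈ z) (xy : before x y w₀ ≡ true) where

      private
        1≤x = proj₁ (letter x∈)
        x≤n = proj₂ (letter x∈)
        1≤y = proj₁ (letter y∈)
        y≤n = proj₂ (letter y∈)

      -- Each configuration of i, x, y has a known defect, which the triangle
      -- inequalities of v turn into V i x ≡ v i x.
      row-i<x<y : i < x → x < y → V i y ≡ v i y → V i x ≡ v i x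
      row-i<x<y i<x x<y Viy≡viy = proj₁ (squeeze (V≤v i x (1≤i , i<x , x≤n)) (V≤v x y (1≤x , x<y , y≤n))
        (subst (v i x + v x y ≤ℤ_) (begin
          v i y              ≡⟨ sym Viy≡viy ⟩
          V i y              ≡⟨ split-with i<x x<y (cong₃ (λ a b c → a + b - c) (γ-from-i x∈) (γ-forward xy) (γ-from-i y∈)) ⟩
          V i x + V x y + + 0 ≡⟨ ℤₚ.+-identityʳ _ ⟩
          V i x + V x y      ∎)
          (proj₁ (triangle i x y 1≤i i<x x<y y≤n))))
        where open ≡-Reasoning

      row-y<i<x : y < i → i < x → V y x ≡ v y x → V i x ≡ v i x
      row-y<i<x y<i i<x Vyx≡vyx = proj₂ (squeeze (V≤v y i (1≤y , y<i , i≤n)) (V≤v i x (1≤i , i<x , x≤n))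
        (subst (v y i + v i x ≤ℤ_) (begin
          v y x              ≡⟨ sym Vyx≡vyx ⟩
          V y x              ≡⟨ split-with y<i i<x (cong₃ (λ a b c → a + b - c) (γ-to-i y∈) (γ-from-i x∈) (γ-backward xy)) ⟩
          V y i + V i x + + 0 ≡⟨ ℤₚ.+-identityʳ _ ⟩
          V y i + V i x      ∎)
          (proj₁ (triangle y i x 1≤y y<i i<x x≤n))))
        where
        open ≡-Reasoning
        i≤n = ℕₚ.≤-trans (ℕₚ.<⇒≤ i<x) x≤n

      row-i<y<x : i < y → y < x → V i y ≡ v i y → V y x ≡ v y x → V i x ≡ v i x
      row-i<y<x i<y y<x Viy≡viy Vyx≡vyx = ℤₚ.≤-antisym (V≤v i x (1≤i , ℕₚ.<-trans i<y y<x , x≤n))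
        (subst (v i x ≤ℤ_) (begin
          v i y + v y x + + 1 ≡⟨ cong₂ (λ a b → a + b + + 1) (sym Viy≡viy) (sym Vyx≡vyx) ⟩
          V i y + V y x + + 1 ≡⟨ sym (split-with i<y y<x (cong₃ (λ a b c → a + b - c) (γ-from-i y∈) (γ-backward xy) (γ-from-i x∈))) ⟩
          V i x               ∎)
          (proj₂ (triangle i y x 1≤i i<y y<x x≤n)))
        where open ≡-Reasoning

      next-letter : ∀ {rest} → Rot w₀ (x ∷ y ∷ rest) → (i < y → V i y ≡ v i y) →
                    Raisable w₀ ⊎ (i < x → V i x ≡ v i x)
      next-letter rot row-y with ℕₚ.<-cmp x y
      ... | tri≈ _ refl _ = contradiction (trans (sym (before-asym u xy)) xy) λ ()
      ... | tri< x<y _ _ = inj₂ λ i<x → row-i<x<y i<x x<y (row-y (ℕₚ.<-trans i<x x<y))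
      ... | tri> _ _ y<x with adjacent p V≤v rot y<x
      ...   | inj₁ raisable = inj₁ raisable
      ...   | inj₂ Vyx≡vyx = inj₂ λ i<x → case ℕₚ.<-cmp y i of λ
        { (tri< y<i _ _) → row-y<i<x y<i i<x Vyx≡vyx
        ; (tri≈ _ y≡i _) → contradiction y≡i (≢i y∈)
        ; (tri> _ _ i<y) → row-i<y<x i<y y<x (row-y i<y) Vyx≡vyx }

    RowAgrees : List ℕ → Set
    RowAgrees b = ∀ {k} → k ∈ b → i < k → V i k ≡ v i k

    row-suffix : ∀ a b → z ≡ a ++ b → Raisable w₀ ⊎ RowAgrees b
    row-suffix a [] _ = inj₂ λ ()
    row-suffix a (x ∷ []) z≡ with last-letter (i ∷ a , [ x ] , cong (i ∷_) z≡ , refl)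
    ... | inj₁ raisable = inj₁ raisable
    ... | inj₂ row-x = inj₂ λ { (here refl) → row-x }
    row-suffix a (x ∷ y ∷ b) z≡ with row-suffix (a ++ [ x ]) (y ∷ b) (trans z≡ (sym (Listₚ.++-assoc a [ x ] (y ∷ b))))
    ... | inj₁ raisable = inj₁ raisable
    ... | inj₂ row-yb with next-letter x∈ y∈ xy (i ∷ a , x ∷ y ∷ b , cong (i ∷_) z≡ , refl) (row-yb (here refl))
      where
      x∈ = subst (x ∈_) (sym z≡) (∈ₚ.∈-++⁺ʳ a (here refl))
      y∈ = subst (y ∈_) (sym z≡) (∈ₚ.∈-++⁺ʳ a (there (here refl)))
      xy : before x y w₀ ≡ true
      xy = subst (λ l → before x y (i ∷ l) ≡ true) (sym z≡)
             (before-split (i ∷ a) (y ∷ b) (subst (λ l → Unique (i ∷ l)) z≡ u) (here refl))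
    ...   | inj₁ raisable = inj₁ raisable
    ...   | inj₂ row-x = inj₂ λ { (here refl) → row-x ; (there k∈) → row-yb k∈ }

  row : ∀ {w} → IsPerm n w → LeT n (V₀ w) v → ∀ i → 1 ≤ i → i ≤ n →
        Raisable w ⊎ (∀ k → i < k → k ≤ n → V₀ w i k ≡ v i k)
  row {w} p V≤v i 1≤i i≤n with rotate-to-front w (perm-∋ p (1≤i , i≤n))
  ... | z , rot with Row.row-suffix (rotate-perm p rot) V₀≤v [] z refl
    where
    V₀≤v : LeT n (V₀ (i ∷ z)) v
    V₀≤v a b t = subst (_≤ℤ v a b) (V₀-rotate p rot a b t) (V≤v a b t)
  ... | inj₁ raisable = inj₁ (Raisable-rotate p rot raisable)
  ... | inj₂ agrees = inj₂ λ k i<k k≤n → trans (V₀-rotate p rot i k (1≤i , i<k , k≤n))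
          (agrees (∈-∷⁻ (perm-∋ (rotate-perm p rot) (ℕₚ.≤-trans 1≤i (ℕₚ.<⇒≤ i<k) , k≤n)) (ℕₚ.>⇒≢ i<k)) i<k)

  raisable-or-equal : ∀ {w} → IsPerm n w → LeT n (V₀ w) v → Raisable w ⊎ EqT n (V₀ w) v
  raisable-or-equal p V≤v with ⊎-∀-bounded n (row p V≤v)
  ... | inj₁ raisable = inj₁ raisable
  ... | inj₂ rows = inj₂ λ i j (1≤i , i<j , j≤n) → rows i 1≤i (ℕₚ.≤-trans (ℕₚ.<⇒≤ i<j) j≤n) j i<j j≤n

  raise : ∀ {w} → IsPerm n w → LeT n (V₀ w) v → Raisable w →
          ∃[ w' ] (Step w w' × IsPerm n w' × LeT n (V₀ w') v × gradeV n (V₀ w) <ℤ gradeV n (V₀ w'))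
  raise {w} p V≤v (s , r , u , sr<s , rot , V<v) =
    r ∷ s ∷ u , step , Step-perm p step , V'≤v , sumT-mono-< (V₀-Step p step) (factor-InT p rot r<s) V<V'
    where
    r<s = ℕₚ.<-trans (ℕₚ.n<1+n r) sr<s
    step : Step w (r ∷ s ∷ u)
    step = s , r , u , sr<s , rot , [] , r ∷ s ∷ u , refl , sym (Listₚ.++-identityʳ _)
    r∉u : r ∉ u
    r∉u = ∉-head (AllPairs.tail (perm-unique (rotate-perm p rot)))
    V≡ : EqT n (V₀ w) (V₀ (s ∷ r ∷ u))
    V≡ = V₀-rotate p rot
    V'≡V+1 : V₀ (r ∷ s ∷ u) r s ≡ V₀ w r s + + 1
    V'≡V+1 = trans (V₀-swap-pair u sr<s r∉u) (cong (_+ + 1) (sym (V≡ r s (factor-InT p rot r<s))))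
    V<V' : V₀ w r s <ℤ V₀ (r ∷ s ∷ u) r s
    V<V' = subst (V₀ w r s <ℤ_) (sym V'≡V+1) (ℤₚ.suc[i]≤j⇒i<j (ℤₚ.≤-reflexive (ℤₚ.+-comm (+ 1) (V₀ w r s))))
    V'≤v : LeT n (V₀ (r ∷ s ∷ u)) v
    V'≤v i j t with i ≟ r | j ≟ s
    ... | yes refl | yes refl = subst (_≤ℤ v r s) (sym V'≡V+1)
                                  (subst (_≤ℤ v r s) (ℤₚ.+-comm (+ 1) (V₀ w r s)) (ℤₚ.i<j⇒suc[i]≤j V<v))
    ... | yes refl | no j≢s =
      subst (_≤ℤ v i j) (trans (V≡ i j t) (sym (V₀-swap u sr<s (proj₁ (proj₂ t)) (j≢s ∘ proj₂)))) (V≤v i j t)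
    ... | no i≢r | _ =
      subst (_≤ℤ v i j) (trans (V≡ i j t) (sym (V₀-swap u sr<s (proj₁ (proj₂ t)) (i≢r ∘ proj₁)))) (V≤v i j t)

  climb : ∀ k {w} → IsPerm n w → LeT n (V₀ w) v → gradeV n v ≤ℤ gradeV n (V₀ w) + + k →
          ∃[ w' ] (CircLe w w' × IsPerm n w' × EqT n (V₀ w') v)
  climb k {w} p V≤v bound with raisable-or-equal p V≤v
  ... | inj₂ V≡v = w , ε , p , V≡v
  ... | inj₁ raisable with raise p V≤v raisable
  ... | w' , step , p' , V'≤v , grade< with k
  ...   | zero = contradiction (ℤₚ.<-≤-trans grade< (ℤₚ.≤-trans (sumT-mono V'≤v)
                   (subst (gradeV n v ≤ℤ_) (ℤₚ.+-identityʳ _) bound))) (ℤₚ.<-irrefl refl)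
  ...   | suc k with w'' , path , p'' , V''≡v ← climb k p' V'≤v (budget-step k bound grade<) =
    w'' , inj₂ step ◅ path , p'' , V''≡v

V₀-reflects-≤ : ∀ {n} → 1 ≤ n → ∀ {w w'} → IsPerm n w → IsPerm n w' → LeT n (V₀ w) (V₀ w') → CircLe w w'
V₀-reflects-≤ {n} 1≤n {w} {w'} p p' V≤V' with Climb.climb (V₀-admitted p') ℤ.∣ gap ∣ p V≤V' bound
  where
  gap = gradeV n (V₀ w') - gradeV n (V₀ w)
  bound : gradeV n (V₀ w') ≤ℤ gradeV n (V₀ w) + + ℤ.∣ gap ∣
  bound rewrite ℤₚ.0≤i⇒+∣i∣≡i (ℤₚ.i≤j⇒0≤j-i (sumT-mono V≤V')) =
    ℤₚ.≤-reflexive (fill (gradeV n (V₀ w')) (gradeV n (V₀ w)))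
    where
    fill : ∀ a b → a ≡ b + (a - b)
    fill = solve-∀
... | w'' , path , p'' , V''≡V' = path ◅◅ (inj₁ (V₀-injective 1≤n w'' w' p'' p' V''≡V') ◅ ε)

theorem3p2 : (n : ℕ) → 2 ≤ n →
  -- V is well defined on circular permutations
  (∀ w w' → IsPerm n w → Rot w w' → EqT n (V₀ w) (V₀ w'))
  -- V takes values in admitted vectors
  × (∀ w → IsPerm n w → Admitted n (V₀ w))
  -- V is injective on circular permutations
  × (∀ w w' → IsPerm n w → IsPerm n w' → EqT n (V₀ w) (V₀ w') → Rot w w')
  -- V is surjective onto admitted vectors
  × (∀ v → Admitted n v → ∃[ w ] (IsPerm n w × EqT n (V₀ w) v))
  -- V is an order isomorphism (order generated by →  vs componentwise)
  × (∀ w w' → IsPerm n w → IsPerm n w' →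
       (CircLe w w' → LeT n (V₀ w) (V₀ w')) × (LeT n (V₀ w) (V₀ w') → CircLe w w'))
  -- V preserves the grading
  × (∀ w → IsPerm n w → N n w ≡ gradeV n (V₀ w))
  -- the inverse: for w = 1w', γ_ij(w) = δ_{1ij}(V₀(w))
  × (∀ w' → IsPerm n (1 ∷ w') → ∀ i j → InT n i j →
       γ i j (1 ∷ w') ≡ δ (V₀ (1 ∷ w')) 1 i j)
theorem3p2 n 2≤n =
  (λ _ _ p rot → V₀-rotate p rot) ,
  (λ _ → V₀-admitted) ,
  V₀-injective 1≤n ,
  V₀-surjective ,
  (λ _ _ p p' → V₀-monotone p , V₀-reflects-≤ 1≤n p p') ,
  (λ w _ → V₀-grading n w) ,
  γ-from-V₀
  where
  1≤n : 1 ≤ n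
  1≤n = ℕₚ.≤-trans (s≤s z≤n) 2≤n
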